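{- For every $n$ there is a bijection $f_4:\mathcal{T}_4\cap\mathcal{A}_n\to\{s\in\mathcal{A}_n\cap(\mathcal{A}^*\setminus\mathcal{P}_1):\mathrm{rpos}(s)\ne0\}$ such that for all $s\in\mathcal{T}_4\cap\mathcal{A}_n$: $\mathrm{asc}(s)=\mathrm{asc}(f_4(s))$, $\mathrm{rep}(s)=\mathrm{rep}(f_4(s))$, $\max(s)=\max(f_4(s))$, $\mathrm{rmin}(s)=\mathrm{rmin}(f_4(s))-1$, $\mathrm{rpos}(s)=\mathrm{rpos}(f_4(s))-1$, $\mathrm{zero}(s)=\mathrm{zero}(f_4(s))+\chi(\mathrm{rpos}(s)=0)$ and $\mathrm{ealm}(s)=\mathrm{ealm}(f_4(s))-\chi(\mathrm{Prm}(s)_{\mathrm{rpos}(s)}=\max(s)+1)$.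
   Context: Inversion sequence: $s=(s_1,\dots,s_n)$, $0\le s_i<i$, $|s|=n$. $\mathrm{asc}(s)=|\{i:s_i<s_{i+1}\}|$. Ascent sequence: $s_i\le\mathrm{asc}(s_1,\dots,s_{i-1})+1$ for $i\ge2$; $\mathcal{A}_n$ = ascent sequences of length $n$; $\mathcal{A}^*$ = all ascent sequences except $(0,1,\dots,|s|-1)$. $\mathrm{rep}(s)=n-|\{s_i\}|$, $\mathrm{zero}(s)=|\{i:s_i=0\}|$, $\max(s)=|\{i:s_i=i-1\}|$, $\mathrm{ealm}(s)=s_{\max(s)+1}$ if $\max(s)\ne|s|$ and $0$ otherwise. An entry $s_i$ is an $\mathcal{M}$asc if $s_i=\mathrm{asc}(s_1,\dots,s_{i-1})+1$. $\mathcal{P}_1=\{s\in\mathcal{A}^*: s_{|s|-1}<s_{|s|}=\mathrm{asc}(s)\}$. $\mathrm{Rmin}(s)=\{s_i:s_i<s_j\ \forall j>i\}$, $\mathrm{rmin}(s)=|\mathrm{Rmin}(s)|$, $\mathrm{Rmin}(s)_j$ its $j$-th smallest element ($j\ge0$); $\mathrm{Prm}(s)$ = set of positions of right-to-left minima, $\mathrm{Prm}(s)_j$ its $j$-th smallest element ($j\ge0$). $\mathrm{rpos}(s)$ is the maximal $m$ such that $\mathrm{Rmin}(s)_m$ occurs at least twice after position $\mathrm{Prm}(s)_{m-1}$ (for $m=0$: at least twice in $s$); $0$ if none exists or $\mathrm{rmin}(s)=|s|$. $\mathrm{sebr}(s)$ = smallest entry strictly between the two rightmost occurrences of $\mathrm{Rmin}(s)_{\mathrm{rpos}(s)}$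 ($0$ if adjacent). Convention: if $\mathrm{rpos}(s)=\mathrm{rmin}(s)-1$ then $\mathrm{sebr}(s)<\mathrm{Rmin}(s)_{\mathrm{rpos}(s)+1}$ is deemed true. $\mathcal{A}^2=\{s\in\mathcal{A}^*:0\ne\mathrm{sebr}(s)<\mathrm{Rmin}(s)_{\mathrm{rpos}(s)+1}\}$ and $\mathcal{T}_4=\{s\in\mathcal{A}^2: s_{|s|}\text{ is not an }\mathcal{M}\text{asc}\}$. $\chi(P)$ is $1$ if $P$ holds and $0$ otherwise. -}

module Defs where

open import Data.Nat using (ℕ; zero; suc; _+_; _∸_; _<_; _≤_; _⊓_; _<ᵇ_; _≡ᵇ_)
open import Data.Bool using (Bool; true; false; if_then_else_)
open import Data.List using (List; []; _∷_; length; take; drop; map; upTo; deduplicate; foldr)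
open import Data.Nat using (_≟_)
open import Data.Product using (_×_)
open import Data.Sum using (_⊎_)
open import Relation.Binary.PropositionalEquality using (_≡_; _≢_)
open import Relation.Nullary using (¬_)

-- 0-indexed lookup with default 0:  at s k = s_{k+1}  (0 if out of range)
at : List ℕ → ℕ → ℕ
at []       _       = 0
at (x ∷ xs) zero    = x
at (x ∷ xs) (suc k) = at xs k

entry : List ℕ → ℕ → ℕ
entry s i = at s (i ∸ 1)

b2n : Bool → ℕ
b2n true  = 1
b2n false = 0

χ : Bool → ℕ
χ = b2n

countB : (ℕ → Bool) → List ℕ → ℕ
countB p []       = 0
countB p (x ∷ xs) = b2n (p x) + countB p xs

asc : List ℕ → ℕ
asc (x ∷ y ∷ xs) = b2n (x <ᵇ y) + asc (y ∷ xs)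
asc _            = 0

-- Inversion-sequence and ascent-sequence conditions (positions i = k+1):
--   s_{k+1} < k+1,  and for k+1 ≥ 2:  s_{k+1} ≤ asc(s_1,...,s_k) + 1
IsAscent : List ℕ → Set
IsAscent s = (k : ℕ) → k < length s →
  (at s k < suc k) × (1 ≤ k → at s k ≤ asc (take k s) + 1)

AStar : List ℕ → Set
AStar s = IsAscent s × (s ≢ upTo (length s))

rep : List ℕ → ℕ
rep s = length s ∸ length (deduplicate _≟_ s)

zeros : List ℕ → ℕ
zeros = countB (λ x → x ≡ᵇ 0)

-- max(s) = |{ i : s_i = i - 1 }|
maxsAux : ℕ → List ℕ → ℕ
maxsAux k []       = 0
maxsAux k (x ∷ xs) = b2n (x ≡ᵇ k) + maxsAux (suc k) xs

maxs : List ℕ → ℕ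
maxs = maxsAux 0

ealm : List ℕ → ℕ
ealm s = if maxs s ≡ᵇ length s then 0 else entry s (maxs s + 1)

LastIsMasc : List ℕ → Set
LastIsMasc s = entry s (length s) ≡ asc (take (length s ∸ 1) s) + 1

P₁ : List ℕ → Set
P₁ s = AStar s × (2 ≤ length s) ×
  ((entry s (length s ∸ 1) < entry s (length s)) × (entry s (length s) ≡ asc s))

allGreater : ℕ → List ℕ → Bool
allGreater x []       = true
allGreater x (y ∷ ys) = if x <ᵇ y then allGreater x ys else false

-- Prm(s): positions (1-indexed, increasing) of right-to-left minima,
-- i.e. of entries s_i with s_i < s_j for all j > i
prmAux : ℕ → List ℕ → List ℕ
prmAux k []       = []
prmAux k (x ∷ xs) =
  if allGreater x xs then suc k ∷ prmAux (suc k) xs else prmAux (suc k) xs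

Prm : List ℕ → List ℕ
Prm = prmAux 0

-- Rmin(s) listed in increasing order (values at the positions Prm(s);
-- right-to-left minima increase from left to right), so that
-- Rmin(s)_j = at (Rmin s) j and Prm(s)_j = at (Prm s) j.
Rmin : List ℕ → List ℕ
Rmin s = map (entry s) (Prm s)

rmin : List ℕ → ℕ
rmin s = length (Rmin s)

occ : ℕ → List ℕ → ℕ
occ v = countB (λ x → x ≡ᵇ v)

-- condition of rpos for a given m: Rmin(s)_m occurs at least twice
-- after position Prm(s)_{m-1} (for m = 0: at least twice in s)
rposCond : List ℕ → ℕ → Bool
rposCond s zero    = 1 <ᵇ occ (at (Rmin s) 0) s
rposCond s (suc m) = 1 <ᵇ occ (at (Rmin s) (suc m)) (drop (at (Prm s) m) s)

-- largest m < k with p m, and 0 if there is none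
lastSat : (ℕ → Bool) → ℕ → ℕ
lastSat p zero    = 0
lastSat p (suc k) = if p k then k else lastSat p k

rpos : List ℕ → ℕ
rpos s = if rmin s ≡ᵇ length s then 0 else lastSat (rposCond s) (rmin s)

occPosAux : ℕ → ℕ → List ℕ → List ℕ
occPosAux v k []       = []
occPosAux v k (x ∷ xs) =
  if x ≡ᵇ v then suc k ∷ occPosAux v (suc k) xs else occPosAux v (suc k) xs

occPos : ℕ → List ℕ → List ℕ
occPos v = occPosAux v 0

-- minimum of a list (0 for the empty list)
minList : List ℕ → ℕ
minList []       = 0
minList (x ∷ xs) = foldr _⊓_ x xs

-- smallest entry strictly between positions a < b (0 if none)
minBetween : List ℕ → ℕ → ℕ → ℕ
minBetween s a b = minList (take (b ∸ suc a) (drop a s))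

-- sebr(s): smallest entry strictly between the two rightmost occurrences of
-- Rmin(s)_{rpos(s)}; 0 if they are adjacent (or if there are fewer than two
-- occurrences, where sebr is not otherwise defined).
sebrAux : List ℕ → List ℕ → ℕ
sebrAux s []             = 0
sebrAux s (a ∷ [])       = 0
sebrAux s (a ∷ b ∷ [])   = minBetween s a b
sebrAux s (a ∷ b ∷ c ∷ ps) = sebrAux s (b ∷ c ∷ ps)

sebr : List ℕ → ℕ
sebr s = sebrAux s (occPos (at (Rmin s) (rpos s)) s)

-- 𝒜² = { s ∈ 𝒜* : 0 ≠ sebr(s) < Rmin(s)_{rpos(s)+1} }, where the second
-- inequality is deemed true when rpos(s) = rmin(s) - 1
A² : List ℕ → Set
A² s = AStar s × (sebr s ≢ 0) ×
  ((suc (rpos s) ≡ rmin s) ⊎ (sebr s < at (Rmin s) (suc (rpos s))))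

T₄ : List ℕ → Set
T₄ s = A² s × ¬ LastIsMasc s

Dom : ℕ → List ℕ → Set
Dom n s = T₄ s × (length s ≡ n)

Cod : ℕ → List ℕ → Set
Cod n s = (length s ≡ n) × AStar s × ¬ P₁ s × (rpos s ≢ 0)

-- Write v = Rmin(s)_{rpos s}, let q < p be its last two occurrences and w = sebr(s) the smallest
-- entry between them. Since s ∈ 𝒜², every entry between q and p is ≥ w > v and every entry after
-- p is > w, so f₄ raises s_p from v to w. Then q becomes a new right-to-left minimum just before
-- p and the rpos condition moves up with the minima, so rmin and rpos grow by one and the raise
-- is undone by lowering the entry at the new rpos-th minimum to the value of its predecessor.
-- The value v survives at q and w already occurred at an earlier position, the comparisons of
-- s_p with its neighbours are the same for v and for w, and p is not a fixed point; this keeps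
-- asc, rep and max, and the ascent and 𝓜asc conditions transfer in both directions.
module Submission where

open import Defs
open import Data.Nat
open import Data.Nat.Properties
open import Data.Bool using (Bool; true; false; T)
open import Data.Bool.Properties using (T-≡)
open import Data.List using (List; []; _∷_; length; take; drop; map; upTo; applyUpTo; _++_; deduplicate; foldr)
import Data.List.Properties as List
open import Data.List.Membership.Propositional using (_∈_)
open import Data.List.Relation.Unary.Any using (here; there)
open import Data.List.Relation.Unary.All using (All; []; _∷_)
import Data.List.Relation.Unary.All as All
open import Data.List.Relation.Unary.AllPairs using (AllPairs; []; _∷_)
open import Data.Product using (Σ; _×_; _,_; proj₁; proj₂; ∃)
open import Data.Sum using (_⊎_; inj₁; inj₂)
open import Data.Empty using (⊥-elim)
open import Data.Unit using (⊤; tt)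
open import Function using (id; _∘′_)
open import Function.Bundles using (Equivalence; mk⇔)
open import Algebra.Properties.CommutativeSemigroup +-commutativeSemigroup using (xy∙z≈zy∙x)
open import Data.List.Membership.Propositional.Properties using (∈-++⁺ˡ; ∈-++⁺ʳ; ∈-++⁻; deduplicate-∈⇔)
open import Data.List.Membership.Propositional.Properties.WithK using (unique∧set⇒bag)
open import Data.List.Relation.Unary.Unique.DecPropositional.Properties _≟_ using (deduplicate-!)
open import Data.List.Relation.Binary.BagAndSetEquality using (∼bag⇒↭)
open import Data.List.Relation.Binary.Permutation.Propositional.Properties using (↭-length)
open import Relation.Nullary using (¬_; yes; no)
open import Relation.Binary.PropositionalEquality
open import Relation.Binary.Definitions using (tri<; tri≈; tri>)

<ᵇ-true⇒< : ∀ {m n} → (m <ᵇ n) ≡ true → m < n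
<ᵇ-true⇒< {m} {n} e = <ᵇ⇒< m n (Equivalence.from T-≡ e)

<⇒<ᵇ-true : ∀ {m n} → m < n → (m <ᵇ n) ≡ true
<⇒<ᵇ-true m<n = Equivalence.to T-≡ (<⇒<ᵇ m<n)

<ᵇ-false⇒≥ : ∀ {m n} → (m <ᵇ n) ≡ false → n ≤ m
<ᵇ-false⇒≥ e = ≮⇒≥ (λ m<n → subst T e (<⇒<ᵇ m<n))

≥⇒<ᵇ-false : ∀ {m n} → n ≤ m → (m <ᵇ n) ≡ false
≥⇒<ᵇ-false {m} {n} n≤m with m <ᵇ n in e
... | true  = ⊥-elim (<⇒≱ (<ᵇ-true⇒< e) n≤m)
... | false = refl

≡ᵇ-true⇒≡ : ∀ {m n} → (m ≡ᵇ n) ≡ true → m ≡ n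
≡ᵇ-true⇒≡ {m} {n} e = ≡ᵇ⇒≡ m n (Equivalence.from T-≡ e)

≡⇒≡ᵇ-true : ∀ {m n} → m ≡ n → (m ≡ᵇ n) ≡ true
≡⇒≡ᵇ-true {m} {n} m≡n = Equivalence.to T-≡ (≡⇒≡ᵇ m n m≡n)

≢⇒≡ᵇ-false : ∀ {m n} → m ≢ n → (m ≡ᵇ n) ≡ false
≢⇒≡ᵇ-false {m} {n} m≢n with m ≡ᵇ n in e
... | true  = ⊥-elim (m≢n (≡ᵇ-true⇒≡ e))
... | false = refl

≢0⇒≡suc : ∀ {n} → n ≢ 0 → Σ ℕ λ r → n ≡ suc r
≢0⇒≡suc {zero}  n≢0 = ⊥-elim (n≢0 refl)
≢0⇒≡suc {suc r} _   = r , refl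

b2n≤1 : ∀ b → b2n b ≤ 1
b2n≤1 true  = ≤-refl
b2n≤1 false = z≤n

-- Indexing and updating lists

infixl 6 _[_]≔_

_[_]≔_ : List ℕ → ℕ → ℕ → List ℕ
[]       [ _     ]≔ _ = []
(x ∷ xs) [ zero  ]≔ w = w ∷ xs
(x ∷ xs) [ suc p ]≔ w = x ∷ xs [ p ]≔ w

length-≔ : ∀ s p w → length (s [ p ]≔ w) ≡ length s
length-≔ []      p       w = refl
length-≔ (x ∷ s) zero    w = refl
length-≔ (x ∷ s) (suc p) w = cong suc (length-≔ s p w)

at-≔-same : ∀ s p w → p < length s → at (s [ p ]≔ w) p ≡ w
at-≔-same (x ∷ s) zero    w _         = refl
at-≔-same (x ∷ s) (suc p) w (s≤s p<n) = at-≔-same s p w p<n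

at-≔-other : ∀ s p w k → k ≢ p → at (s [ p ]≔ w) k ≡ at s k
at-≔-other []      p       w k       k≢p = refl
at-≔-other (x ∷ s) zero    w zero    k≢p = ⊥-elim (k≢p refl)
at-≔-other (x ∷ s) zero    w (suc k) k≢p = refl
at-≔-other (x ∷ s) (suc p) w zero    k≢p = refl
at-≔-other (x ∷ s) (suc p) w (suc k) k≢p = at-≔-other s p w k (k≢p ∘′ cong suc)

≔-≔ : ∀ s p a b → s [ p ]≔ a [ p ]≔ b ≡ s [ p ]≔ b
≔-≔ []      p       a b = refl
≔-≔ (x ∷ s) zero    a b = refl
≔-≔ (x ∷ s) (suc p) a b = cong (x ∷_) (≔-≔ s p a b)

≔-at : ∀ s p → s [ p ]≔ at s p ≡ s
≔-at []      p       = refl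
≔-at (x ∷ s) zero    = refl
≔-at (x ∷ s) (suc p) = cong (x ∷_) (≔-at s p)

take-≔ : ∀ s p w k → take k (s [ p ]≔ w) ≡ take k s [ p ]≔ w
take-≔ []      p       w zero    = refl
take-≔ []      p       w (suc k) = refl
take-≔ (x ∷ s) p       w zero    = refl
take-≔ (x ∷ s) zero    w (suc k) = refl
take-≔ (x ∷ s) (suc p) w (suc k) = cong (x ∷_) (take-≔ s p w k)

≔-beyond : ∀ s p w → length s ≤ p → s [ p ]≔ w ≡ s
≔-beyond []      p       w _         = refl
≔-beyond (x ∷ s) (suc p) w (s≤s n≤p) = cong (x ∷_) (≔-beyond s p w n≤p)

drop-≔ : ∀ s p w d → p < d → drop d (s [ p ]≔ w) ≡ drop d s
drop-≔ []      p       w d       _         = refl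
drop-≔ (x ∷ s) zero    w (suc d) _         = refl
drop-≔ (x ∷ s) (suc p) w (suc d) (s≤s p<d) = drop-≔ s p w d p<d

at-drop : ∀ s d k → at (drop d s) k ≡ at s (d + k)
at-drop []      zero    k = refl
at-drop []      (suc d) k = refl
at-drop (x ∷ s) zero    k = refl
at-drop (x ∷ s) (suc d) k = at-drop s d k

at-take : ∀ s m k → k < m → at (take m s) k ≡ at s k
at-take []      (suc m) k       _         = refl
at-take (x ∷ s) (suc m) zero    _         = refl
at-take (x ∷ s) (suc m) (suc k) (s≤s k<m) = at-take s m k k<m

at-beyond : ∀ s k → length s ≤ k → at s k ≡ 0
at-beyond []      k       _         = refl
at-beyond (x ∷ s) (suc k) (s≤s n≤k) = at-beyond s k n≤k

at-map : ∀ (f : ℕ → ℕ) xs j → j < length xs → at (map f xs) j ≡ f (at xs j)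
at-map f (x ∷ xs) zero    _         = refl
at-map f (x ∷ xs) (suc j) (s≤s j<n) = at-map f xs j j<n

at-upTo : ∀ n k → k < n → at (upTo n) k ≡ k
at-upTo n k = at-applyUpTo id n k
  where
  at-applyUpTo : ∀ f n k → k < n → at (applyUpTo f n) k ≡ f k
  at-applyUpTo f (suc n) zero    _         = refl
  at-applyUpTo f (suc n) (suc k) (s≤s k<n) = at-applyUpTo (f ∘′ suc) n k k<n

≡upTo⇒distinct : ∀ xs a b → a < b → b < length xs → xs ≡ upTo (length xs) → at xs a ≢ at xs b
≡upTo⇒distinct xs a b a<b b<n xs≡ e = <⇒≢ a<b (begin
  a                         ≡⟨ sym (at-upTo (length xs) a (<-trans a<b b<n)) ⟩
  at (upTo (length xs)) a   ≡⟨ cong (λ z → at z a) (sym xs≡) ⟩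
  at xs a                   ≡⟨ e ⟩
  at xs b                   ≡⟨ cong (λ z → at z b) xs≡ ⟩
  at (upTo (length xs)) b   ≡⟨ at-upTo (length xs) b b<n ⟩
  b                         ∎)
  where open ≡-Reasoning

at-extensionality : ∀ (xs ys : List ℕ) → length xs ≡ length ys →
                    (∀ k → k < length xs → at xs k ≡ at ys k) → xs ≡ ys
at-extensionality []       []       _ _  = refl
at-extensionality (x ∷ xs) (y ∷ ys) e eq =
  cong₂ _∷_ (eq 0 z<s) (at-extensionality xs ys (suc-injective e) (λ k k<n → eq (suc k) (s≤s k<n)))

∈⇒at : ∀ {x} (xs : List ℕ) → x ∈ xs → Σ ℕ λ k → k < length xs × at xs k ≡ x
∈⇒at (y ∷ xs) (here refl) = 0 , z<s , refl
∈⇒at (y ∷ xs) (there x∈xs) with ∈⇒at xs x∈xs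
... | k , k<n , e = suc k , s≤s k<n , e

at-∈ : ∀ (xs : List ℕ) k → k < length xs → at xs k ∈ xs
at-∈ (y ∷ xs) zero    _         = here refl
at-∈ (y ∷ xs) (suc k) (s≤s k<n) = there (at-∈ xs k k<n)

All-at : ∀ {P : ℕ → Set} {xs} → All P xs → ∀ k → k < length xs → P (at xs k)
All-at (px ∷ _)   zero    _         = px
All-at (_  ∷ pxs) (suc k) (s≤s k<n) = All-at pxs k k<n

All-tabulate-at : ∀ {P : ℕ → Set} xs → (∀ k → k < length xs → P (at xs k)) → All P xs
All-tabulate-at []       _ = []
All-tabulate-at (x ∷ xs) h = h 0 z<s ∷ All-tabulate-at xs (λ k k<n → h (suc k) (s≤s k<n))

Increasing : List ℕ → Set
Increasing = AllPairs _<_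

module _ {L : List ℕ} (L↑ : Increasing L) where

  increasing⇒at-< : ∀ i j → i < j → j < length L → at L i < at L j
  increasing⇒at-< = go L↑
    where
    go : ∀ {L} → Increasing L → ∀ i j → i < j → j < length L → at L i < at L j
    go (x< ∷ _)  zero    (suc j) _         (s≤s j<n) = All-at x< j j<n
    go (_ ∷ L↑′) (suc i) (suc j) (s≤s i<j) (s≤s j<n) = go L↑′ i j i<j j<n

  increasing⇒at-≤ : ∀ i j → i ≤ j → j < length L → at L i ≤ at L j
  increasing⇒at-≤ i j i≤j j<n with m≤n⇒m<n∨m≡n i≤j
  ... | inj₁ i<j  = <⇒≤ (increasing⇒at-< i j i<j j<n)
  ... | inj₂ refl = ≤-refl

  increasing⇒at-<-reflect : ∀ i j → i < length L → j < length L → at L i < at L j → i < j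
  increasing⇒at-<-reflect i j i<n j<n lt with <-cmp i j
  ... | tri< i<j _ _ = i<j
  ... | tri≈ _ refl _ = ⊥-elim (<-irrefl refl lt)
  ... | tri> _ _ j<i = ⊥-elim (<-asym lt (increasing⇒at-< j i j<i i<n))

  increasing⇒at-injective : ∀ i j → i < length L → j < length L → at L i ≡ at L j → i ≡ j
  increasing⇒at-injective i j i<n j<n e with <-cmp i j
  ... | tri< i<j _ _ = ⊥-elim (<⇒≢ (increasing⇒at-< i j i<j j<n) e)
  ... | tri≈ _ i≡j _ = i≡j
  ... | tri> _ _ j<i = ⊥-elim (<⇒≢ (increasing⇒at-< j i j<i i<n) (sym e))

  increasing-split : ∀ q → Σ ℕ λ r → r ≤ length L
                   × (∀ i → i < r → at L i ≤ q) × (∀ i → r ≤ i → i < length L → q < at L i)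
  increasing-split = go L↑
    where
    go : ∀ {L} → Increasing L → ∀ q → Σ ℕ λ r → r ≤ length L
       × (∀ i → i < r → at L i ≤ q) × (∀ i → r ≤ i → i < length L → q < at L i)
    go [] q = 0 , z≤n , (λ _ ()) , (λ _ _ ())
    go {x ∷ xs} (x< ∷ xs↑) q with x ≤? q
    ... | no x≰q = 0 , z≤n , (λ _ ()) , above
      where
      above : ∀ i → 0 ≤ i → i < suc (length xs) → q < at (x ∷ xs) i
      above zero    _ _         = ≰⇒> x≰q
      above (suc i) _ (s≤s i<n) = <-trans (≰⇒> x≰q) (All-at x< i i<n)
    ... | yes x≤q with go xs↑ q
    ... | r , r≤n , below , above = suc r , s≤s r≤n , below′ , above′
      where
      below′ : ∀ i → i < suc r → at (x ∷ xs) i ≤ q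
      below′ zero    _         = x≤q
      below′ (suc i) (s≤s i<r) = below i i<r
      above′ : ∀ i → suc r ≤ i → i < suc (length xs) → q < at (x ∷ xs) i
      above′ (suc i) (s≤s r≤i) (s≤s i<n) = above i r≤i i<n

increasing-sameMembers⇒≡ : ∀ {L M} → Increasing L → Increasing M →
               (∀ y → y ∈ L → y ∈ M) → (∀ y → y ∈ M → y ∈ L) → L ≡ M
increasing-sameMembers⇒≡ []       []       _ _ = refl
increasing-sameMembers⇒≡ []       (_ ∷ _)  _ M⊆L with M⊆L _ (here refl)
... | ()
increasing-sameMembers⇒≡ (_ ∷ _)  []       L⊆M _ with L⊆M _ (here refl)
... | ()
increasing-sameMembers⇒≡ {x ∷ xs} {y ∷ ys} (x< ∷ xs↑) (y< ∷ ys↑) L⊆M M⊆L =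
  cong₂ _∷_ x≡y (increasing-sameMembers⇒≡ xs↑ ys↑ xs⊆ys ys⊆xs)
  where
  x≡y : x ≡ y
  x≡y with L⊆M x (here refl) | M⊆L y (here refl)
  ... | here e    | _         = e
  ... | there _   | here e    = sym e
  ... | there x∈ys | there y∈xs = ⊥-elim (<-asym (All.lookup y< x∈ys) (All.lookup x< y∈xs))
  xs⊆ys : ∀ z → z ∈ xs → z ∈ ys
  xs⊆ys z z∈xs with L⊆M z (there z∈xs)
  ... | here refl  = ⊥-elim (<-irrefl x≡y (All.lookup x< z∈xs))
  ... | there z∈ys = z∈ys
  ys⊆xs : ∀ z → z ∈ ys → z ∈ xs
  ys⊆xs z z∈ys with M⊆L z (there z∈ys)
  ... | here refl  = ⊥-elim (<-irrefl (sym x≡y) (All.lookup y< z∈ys))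
  ... | there z∈xs = z∈xs

insertAt : List ℕ → ℕ → ℕ → List ℕ
insertAt L r y = take r L ++ y ∷ drop r L

length-insertAt : ∀ L r y → r ≤ length L → length (insertAt L r y) ≡ suc (length L)
length-insertAt L       zero    y _         = refl
length-insertAt (x ∷ L) (suc r) y (s≤s r≤n) = cong suc (length-insertAt L r y r≤n)

at-insertAt-< : ∀ L r y j → r ≤ length L → j < r → at (insertAt L r y) j ≡ at L j
at-insertAt-< (x ∷ L) (suc r) y zero    _         _         = refl
at-insertAt-< (x ∷ L) (suc r) y (suc j) (s≤s r≤n) (s≤s j<r) = at-insertAt-< L r y j r≤n j<r

at-insertAt-≡ : ∀ L r y → r ≤ length L → at (insertAt L r y) r ≡ y
at-insertAt-≡ L       zero    y _         = refl
at-insertAt-≡ (x ∷ L) (suc r) y (s≤s r≤n) = at-insertAt-≡ L r y r≤n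

at-insertAt-> : ∀ L r y j → r ≤ length L → r ≤ j → at (insertAt L r y) (suc j) ≡ at L j
at-insertAt-> L       zero    y j       _         _         = refl
at-insertAt-> (x ∷ L) (suc r) y (suc j) (s≤s r≤n) (s≤s r≤j) = at-insertAt-> L r y j r≤n r≤j

increasing-insertAt : ∀ {L} → Increasing L → ∀ r y → r ≤ length L →
                      (∀ i → i < r → at L i < y) → (∀ i → r ≤ i → i < length L → y < at L i) →
                      Increasing (insertAt L r y)
increasing-insertAt {L} L↑ zero y _ _ above = All-tabulate-at L (λ k k<n → above k z≤n k<n) ∷ L↑
increasing-insertAt {x ∷ L} (x< ∷ L↑) (suc r) y (s≤s r≤n) below above =
  All-tabulate-at (insertAt L r y) x<ins ∷
  increasing-insertAt L↑ r y r≤n (λ i i<r → below (suc i) (s≤s i<r)) (λ i r≤i i<n → above (suc i) (s≤s r≤i) (s≤s i<n))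
  where
  x<ins : ∀ k → k < length (insertAt L r y) → x < at (insertAt L r y) k
  x<ins k k<n with <-cmp k r
  ... | tri< k<r _ _  = subst (x <_) (sym (at-insertAt-< L r y k r≤n k<r)) (All-at x< k (<-≤-trans k<r r≤n))
  ... | tri≈ _ refl _ = subst (x <_) (sym (at-insertAt-≡ L k y r≤n)) (below 0 z<s)
  x<ins (suc k) k<n | tri> _ _ r<k =
    subst (x <_) (sym (at-insertAt-> L r y k r≤n (≤-pred r<k)))
          (All-at x< k (≤-pred (subst (suc k <_) (length-insertAt L r y r≤n) k<n)))

∈-insertAt⁻ : ∀ {x} L r y → x ∈ insertAt L r y → x ≡ y ⊎ x ∈ L
∈-insertAt⁻ {x} L r y x∈ with ∈-++⁻ (take r L) x∈
... | inj₁ x∈take        = inj₂ (subst (x ∈_) (List.take++drop≡id r L) (∈-++⁺ˡ x∈take))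
... | inj₂ (here x≡y)    = inj₁ x≡y
... | inj₂ (there x∈drop) = inj₂ (subst (x ∈_) (List.take++drop≡id r L) (∈-++⁺ʳ (take r L) x∈drop))

∈-insertAt⁺ : ∀ {x} L r y → x ≡ y ⊎ x ∈ L → x ∈ insertAt L r y
∈-insertAt⁺ L r y (inj₁ refl) = ∈-++⁺ʳ (take r L) (here refl)
∈-insertAt⁺ {x} L r y (inj₂ x∈L) with ∈-++⁻ (take r L) (subst (x ∈_) (sym (List.take++drop≡id r L)) x∈L)
... | inj₁ x∈take = ∈-++⁺ˡ x∈take
... | inj₂ x∈drop = ∈-++⁺ʳ (take r L) (there x∈drop)

-- Right-to-left minima

IsRmin : List ℕ → ℕ → Set
IsRmin s i = ∀ j → i < j → j < length s → at s i < at s j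

allGreater⇒< : ∀ x xs → allGreater x xs ≡ true → ∀ k → k < length xs → x < at xs k
allGreater⇒< x (y ∷ xs) e k k<n with x <ᵇ y in x<y
allGreater⇒< x (y ∷ xs) e zero    _         | true = <ᵇ-true⇒< x<y
allGreater⇒< x (y ∷ xs) e (suc k) (s≤s k<n) | true = allGreater⇒< x xs e k k<n

<⇒allGreater : ∀ x xs → (∀ k → k < length xs → x < at xs k) → allGreater x xs ≡ true
<⇒allGreater x []       _ = refl
<⇒allGreater x (y ∷ xs) h rewrite <⇒<ᵇ-true (h 0 z<s) = <⇒allGreater x xs (λ k k<n → h (suc k) (s≤s k<n))

allGreater-false⇒≤ : ∀ x xs → allGreater x xs ≡ false → Σ ℕ λ k → k < length xs × at xs k ≤ x
allGreater-false⇒≤ x (y ∷ xs) e with x <ᵇ y in x<y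
... | false = 0 , z<s , <ᵇ-false⇒≥ x<y
... | true with allGreater-false⇒≤ x xs e
...   | k , k<n , ≤x = suc k , s≤s k<n , ≤x

isRmin-zero⇒allGreater : ∀ x xs → IsRmin (x ∷ xs) 0 → allGreater x xs ≡ true
isRmin-zero⇒allGreater x xs h = <⇒allGreater x xs (λ k k<n → h (suc k) z<s (s≤s k<n))

allGreater⇒isRmin-zero : ∀ x xs → allGreater x xs ≡ true → IsRmin (x ∷ xs) 0
allGreater⇒isRmin-zero x xs e (suc j) _ (s≤s j<n) = allGreater⇒< x xs e j j<n

isRmin-suc⁻ : ∀ x xs i → IsRmin (x ∷ xs) (suc i) → IsRmin xs i
isRmin-suc⁻ x xs i h j i<j j<n = h (suc j) (s≤s i<j) (s≤s j<n)

isRmin-suc⁺ : ∀ x xs i → IsRmin xs i → IsRmin (x ∷ xs) (suc i)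
isRmin-suc⁺ x xs i h (suc j) (s≤s i<j) (s≤s j<n) = h j i<j j<n

∈-prmAux⁻ : ∀ k xs y → y ∈ prmAux k xs → Σ ℕ λ i → i < length xs × y ≡ k + suc i × IsRmin xs i
∈-prmAux⁻ k (x ∷ xs) y y∈ with allGreater x xs in e
∈-prmAux⁻ k (x ∷ xs) y (here refl) | true = 0 , z<s , +-comm 1 k , allGreater⇒isRmin-zero x xs e
∈-prmAux⁻ k (x ∷ xs) y (there y∈)  | true with ∈-prmAux⁻ (suc k) xs y y∈
... | i , i<n , refl , rm = suc i , s≤s i<n , sym (+-suc k (suc i)) , isRmin-suc⁺ x xs i rm
∈-prmAux⁻ k (x ∷ xs) y y∈ | false with ∈-prmAux⁻ (suc k) xs y y∈
... | i , i<n , refl , rm = suc i , s≤s i<n , sym (+-suc k (suc i)) , isRmin-suc⁺ x xs i rm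

∈-prmAux⁺ : ∀ k xs i → i < length xs → IsRmin xs i → k + suc i ∈ prmAux k xs
∈-prmAux⁺ k (x ∷ xs) zero _ rm rewrite isRmin-zero⇒allGreater x xs rm = here (+-comm k 1)
∈-prmAux⁺ k (x ∷ xs) (suc i) (s≤s i<n) rm with allGreater x xs
... | true  = there rec
  where rec = subst (_∈ prmAux (suc k) xs) (sym (+-suc k (suc i))) (∈-prmAux⁺ (suc k) xs i i<n (isRmin-suc⁻ x xs i rm))
... | false = subst (_∈ prmAux (suc k) xs) (sym (+-suc k (suc i))) (∈-prmAux⁺ (suc k) xs i i<n (isRmin-suc⁻ x xs i rm))

prmAux-increasing : ∀ k xs → Increasing (prmAux k xs)
prmAux-increasing k []       = []
prmAux-increasing k (x ∷ xs) with allGreater x xs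
... | true  = All.tabulate k<tail ∷ prmAux-increasing (suc k) xs
  where
  k<tail : ∀ {y} → y ∈ prmAux (suc k) xs → suc k < y
  k<tail {y} y∈ with ∈-prmAux⁻ (suc k) xs y y∈
  ... | _ , _ , refl , _ = m<m+n (suc k) z<s
... | false = prmAux-increasing (suc k) xs

length-prmAux≤ : ∀ k xs → length (prmAux k xs) ≤ length xs
length-prmAux≤ k []       = z≤n
length-prmAux≤ k (x ∷ xs) with allGreater x xs
... | true  = s≤s (length-prmAux≤ (suc k) xs)
... | false = m≤n⇒m≤1+n (length-prmAux≤ (suc k) xs)

length-prmAux≡⇒isRmin : ∀ k xs → length (prmAux k xs) ≡ length xs → ∀ i → i < length xs → IsRmin xs i
length-prmAux≡⇒isRmin k (x ∷ xs) e i i<n with allGreater x xs in ag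
length-prmAux≡⇒isRmin k (x ∷ xs) e zero    _         | true = allGreater⇒isRmin-zero x xs ag
length-prmAux≡⇒isRmin k (x ∷ xs) e (suc i) (s≤s i<n) | true =
  isRmin-suc⁺ x xs i (length-prmAux≡⇒isRmin (suc k) xs (suc-injective e) i i<n)
... | false = ⊥-elim (<-irrefl e (s≤s (length-prmAux≤ (suc k) xs)))

-- Prm s holds 1-based positions, hence the ∸ 1
rminValue : List ℕ → ℕ → ℕ
rminValue s j = at s (at (Prm s) j ∸ 1)

rmin≡length-Prm : ∀ s → rmin s ≡ length (Prm s)
rmin≡length-Prm s = List.length-map (entry s) (Prm s)

at-Rmin : ∀ s j → j < length (Prm s) → at (Rmin s) j ≡ rminValue s j
at-Rmin s j = at-map (entry s) (Prm s) j

∈-Prm⁻ : ∀ s y → y ∈ Prm s → Σ ℕ λ i → y ≡ suc i × i < length s × IsRmin s i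
∈-Prm⁻ s y y∈ with ∈-prmAux⁻ 0 s y y∈
... | i , i<n , e , rm = i , e , i<n , rm

∈-Prm⁺ : ∀ s i → i < length s → IsRmin s i → suc i ∈ Prm s
∈-Prm⁺ s = ∈-prmAux⁺ 0 s

Prm-increasing : ∀ s → Increasing (Prm s)
Prm-increasing = prmAux-increasing 0

at-Prm : ∀ s j → j < length (Prm s) → Σ ℕ λ i → at (Prm s) j ≡ suc i × i < length s × IsRmin s i
at-Prm s j j<n = ∈-Prm⁻ s _ (at-∈ (Prm s) j j<n)

length-Prm≡⇒isRmin : ∀ s → length (Prm s) ≡ length s → ∀ i → i < length s → IsRmin s i
length-Prm≡⇒isRmin = length-prmAux≡⇒isRmin 0

rminValue-< : ∀ s i j → i < j → j < length (Prm s) → rminValue s i < rminValue s j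
rminValue-< s i j i<j j<n
  with at-Prm s i (<-trans i<j j<n) | at-Prm s j j<n | increasing⇒at-< (Prm-increasing s) i j i<j j<n
... | a , ea , _ , rm | b , eb , b<n , _ | Pi<Pj rewrite ea | eb = rm b (≤-pred Pi<Pj) b<n

rminValue-≤ : ∀ s i j → i ≤ j → j < length (Prm s) → rminValue s i ≤ rminValue s j
rminValue-≤ s i j i≤j j<n with m≤n⇒m<n∨m≡n i≤j
... | inj₁ i<j  = <⇒≤ (rminValue-< s i j i<j j<n)
... | inj₂ refl = ≤-refl

last∈Prm : ∀ s m → length s ≡ suc m → suc m ∈ Prm s
last∈Prm s m n≡ = ∈-Prm⁺ s m (subst (m <_) (sym n≡) ≤-refl)
                    (λ j m<j j<n → ⊥-elim (<⇒≱ m<j (≤-pred (subst (j <_) n≡ j<n))))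

Prm-last : ∀ s m → length s ≡ suc m → Σ ℕ λ L → length (Prm s) ≡ suc L × at (Prm s) L ≡ suc m
Prm-last s m n≡ with length (Prm s) in P≡ | ∈⇒at (Prm s) (last∈Prm s m n≡)
... | zero  | k , () , _
... | suc L | k , s≤s k≤L , P[k] = L , refl , ≤-antisym last≤ ≤last
  where
  L<P : L < length (Prm s)
  L<P = subst (L <_) (sym P≡) ≤-refl
  last≤ : at (Prm s) L ≤ suc m
  last≤ with at-Prm s L L<P
  ... | i , e , i<n , _ rewrite e = s≤s (≤-pred (subst (i <_) n≡ i<n))
  ≤last : suc m ≤ at (Prm s) L
  ≤last = subst (_≤ at (Prm s) L) P[k] (increasing⇒at-≤ (Prm-increasing s) k L k≤L L<P)

rmin>0 : ∀ s → 0 < length s → 0 < rmin s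
rmin>0 s 0<n with length s in n≡ | 0<n
... | suc m | _ = subst (0 <_) (sym (rmin≡length-Prm s)) (<-≤-trans z<s (proj₁ (proj₂ (∈⇒at (Prm s) (last∈Prm s m n≡)))))

rmin-at-or-after : ∀ s k → k < length s → Σ ℕ λ i → k ≤ i × i < length s × IsRmin s i × at s i ≤ at s k
rmin-at-or-after (x ∷ xs) (suc k) (s≤s k<n) with rmin-at-or-after xs k k<n
... | i , k≤i , i<n , rm , ≤s[k] = suc i , s≤s k≤i , s≤s i<n , isRmin-suc⁺ x xs i rm , ≤s[k]
rmin-at-or-after (x ∷ xs) zero _ with allGreater x xs in ag
... | true  = 0 , z≤n , z<s , allGreater⇒isRmin-zero x xs ag , ≤-refl
... | false with allGreater-false⇒≤ x xs ag
... | j , j<n , xs[j]≤x with rmin-at-or-after xs j j<n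
... | i , _ , i<n , rm , ≤xs[j] = suc i , z≤n , s≤s i<n , isRmin-suc⁺ x xs i rm , ≤-trans ≤xs[j] xs[j]≤x

-- the 0-based position k lies after the first m right-to-left minima (≤ since Prm s is 1-based)
AfterRmin : List ℕ → ℕ → ℕ → Set
AfterRmin s zero    k = ⊤
AfterRmin s (suc m) k = at (Prm s) m ≤ k

afterRmin-intro : ∀ s m k → (∀ i → i < m → at (Prm s) i ≤ k) → AfterRmin s m k
afterRmin-intro s zero    k _ = tt
afterRmin-intro s (suc m) k h = h m ≤-refl

afterRmin-≤ : ∀ s m {k k′} → AfterRmin s m k → k ≤ k′ → AfterRmin s m k′
afterRmin-≤ s zero    _   _    = tt
afterRmin-≤ s (suc m) P≤k k≤k′ = ≤-trans P≤k k≤k′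

rminValue-≤-after : ∀ s j k → j < length (Prm s) → AfterRmin s j k → k < length s → rminValue s j ≤ at s k
rminValue-≤-after s j k j<P after k<n with rmin-at-or-after s k k<n
... | i , k≤i , i<n , rm , s[i]≤s[k] with ∈⇒at (Prm s) (∈-Prm⁺ s i i<n rm)
... | j″ , j″<P , P[j″] =
  ≤-trans (rminValue-≤ s j j″ (index-≤ j j<P after) j″<P) (subst (λ z → at s (z ∸ 1) ≤ at s k) (sym P[j″]) s[i]≤s[k])
  where
  index-≤ : ∀ j → j < length (Prm s) → AfterRmin s j k → j ≤ j″
  index-≤ zero     _   _     = z≤n
  index-≤ (suc j′) j<P after = increasing⇒at-<-reflect (Prm-increasing s) j′ j″ (<-trans (n<1+n j′) j<P) j″<P
                                 (subst (at (Prm s) j′ <_) (sym P[j″]) (s≤s (≤-trans after k≤i)))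

rep-sameElements : ∀ (a b : List ℕ) → length a ≡ length b →
                   (∀ x → x ∈ a → x ∈ b) → (∀ x → x ∈ b → x ∈ a) → rep a ≡ rep b
rep-sameElements a b len a⊆b b⊆a = cong₂ _∸_ len (↭-length (∼bag⇒↭ (unique∧set⇒bag (deduplicate-! a) (deduplicate-! b)
  (λ {x} → mk⇔ (to ∘′ a⊆b x ∘′ from) (to ∘′ b⊆a x ∘′ from)))))
  where
  to : ∀ {x xs} → x ∈ xs → x ∈ deduplicate _≟_ xs
  to = Equivalence.to (deduplicate-∈⇔ _≟_)
  from : ∀ {x xs} → x ∈ deduplicate _≟_ xs → x ∈ xs
  from = Equivalence.from (deduplicate-∈⇔ _≟_)

countB-≔ : ∀ f xs p w → p < length xs → countB f (xs [ p ]≔ w) + b2n (f (at xs p)) ≡ countB f xs + b2n (f w)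
countB-≔ f (x ∷ xs) zero    w _         = xy∙z≈zy∙x (b2n (f w)) (countB f xs) (b2n (f x))
countB-≔ f (x ∷ xs) (suc p) w (s≤s p<n) = begin
  b2n (f x) + countB f (xs [ p ]≔ w) + b2n (f (at xs p)) ≡⟨ +-assoc (b2n (f x)) _ _ ⟩
  b2n (f x) + (countB f (xs [ p ]≔ w) + b2n (f (at xs p))) ≡⟨ cong (b2n (f x) +_) (countB-≔ f xs p w p<n) ⟩
  b2n (f x) + (countB f xs + b2n (f w))                  ≡⟨ +-assoc (b2n (f x)) _ _ ⟨
  b2n (f x) + countB f xs + b2n (f w)                    ∎
  where open ≡-Reasoning

index-drop : ∀ (s : List ℕ) d k → k < length (drop d s) → d + k < length s
index-drop (x ∷ s) zero    k k<n = k<n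
index-drop (x ∷ s) (suc d) k k<n = s≤s (index-drop s d k k<n)

occ≥1⁻ : ∀ v xs → 1 ≤ occ v xs → Σ ℕ λ b → b < length xs × at xs b ≡ v
occ≥1⁻ v (x ∷ xs) h with x ≡ᵇ v in x≡v
... | true  = 0 , z<s , ≡ᵇ-true⇒≡ x≡v
... | false with occ≥1⁻ v xs h
...   | b , b<n , xs[b] = suc b , s≤s b<n , xs[b]

occ≥1⁺ : ∀ v xs b → b < length xs → at xs b ≡ v → 1 ≤ occ v xs
occ≥1⁺ v (x ∷ xs) zero    _         x≡v rewrite ≡⇒≡ᵇ-true x≡v = s≤s z≤n
occ≥1⁺ v (x ∷ xs) (suc b) (s≤s b<n) e   = ≤-trans (occ≥1⁺ v xs b b<n e) (m≤n+m _ (b2n (x ≡ᵇ v)))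

occ≥2⁻ : ∀ v xs → 2 ≤ occ v xs → Σ ℕ λ a → Σ ℕ λ b → a < b × b < length xs × at xs a ≡ v × at xs b ≡ v
occ≥2⁻ v (x ∷ xs) h with x ≡ᵇ v in x≡v
... | true with occ≥1⁻ v xs (≤-pred h)
...   | b , b<n , xs[b] = 0 , suc b , z<s , s≤s b<n , ≡ᵇ-true⇒≡ x≡v , xs[b]
occ≥2⁻ v (x ∷ xs) h | false with occ≥2⁻ v xs h
... | a , b , a<b , b<n , xs[a] , xs[b] = suc a , suc b , s≤s a<b , s≤s b<n , xs[a] , xs[b]

occ≥2⁺ : ∀ v xs a b → a < b → b < length xs → at xs a ≡ v → at xs b ≡ v → 2 ≤ occ v xs
occ≥2⁺ v (x ∷ xs) zero    (suc b) _         (s≤s b<n) x≡v e rewrite ≡⇒≡ᵇ-true x≡v = s≤s (occ≥1⁺ v xs b b<n e)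
occ≥2⁺ v (x ∷ xs) (suc a) (suc b) (s≤s a<b) (s≤s b<n) ea eb =
  ≤-trans (occ≥2⁺ v xs a b a<b b<n ea eb) (m≤n+m _ (b2n (x ≡ᵇ v)))

occ-drop-twice⁻ : ∀ v s d → (1 <ᵇ occ v (drop d s)) ≡ true →
                  Σ ℕ λ a → Σ ℕ λ b → d ≤ a × a < b × b < length s × at s a ≡ v × at s b ≡ v
occ-drop-twice⁻ v s d twice with occ≥2⁻ v (drop d s) (<ᵇ-true⇒< twice)
... | a , b , a<b , b<n , ea , eb =
  d + a , d + b , m≤m+n d a , +-monoʳ-< d a<b , index-drop s d b b<n ,
  trans (sym (at-drop s d a)) ea , trans (sym (at-drop s d b)) eb

occ-drop-twice⁺ : ∀ v s d a b → d ≤ a → a < b → b < length s → at s a ≡ v → at s b ≡ v →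
                  (1 <ᵇ occ v (drop d s)) ≡ true
occ-drop-twice⁺ v s d a b d≤a a<b b<n ea eb = <⇒<ᵇ-true (occ≥2⁺ v (drop d s) (a ∸ d) (b ∸ d)
  (∸-monoˡ-< a<b d≤a)
  (subst (b ∸ d <_) (sym (List.length-drop d s)) (∸-monoˡ-< b<n d≤b))
  (trans (at-drop s d (a ∸ d)) (trans (cong (at s) (m+[n∸m]≡n d≤a)) ea))
  (trans (at-drop s d (b ∸ d)) (trans (cong (at s) (m+[n∸m]≡n d≤b)) eb)))
  where
  d≤b = ≤-trans d≤a (<⇒≤ a<b)

rposCond⁺ : ∀ s m a b → AfterRmin s m a → a < b → b < length s →
            at s a ≡ at (Rmin s) m → at s b ≡ at (Rmin s) m → rposCond s m ≡ true
rposCond⁺ s zero    a b _     = occ-drop-twice⁺ _ s 0 a b z≤n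
rposCond⁺ s (suc m) a b after = occ-drop-twice⁺ _ s (at (Prm s) m) a b after

rposCond⁻ : ∀ s m → rposCond s m ≡ true → Σ ℕ λ a → Σ ℕ λ b → AfterRmin s m a × a < b × b < length s ×
            at s a ≡ at (Rmin s) m × at s b ≡ at (Rmin s) m
rposCond⁻ s zero cond with occ-drop-twice⁻ _ s 0 cond
... | a , b , _ , rest = a , b , tt , rest
rposCond⁻ s (suc m) cond = occ-drop-twice⁻ _ s (at (Prm s) m) cond

∈-occPosAux⁻ : ∀ v k xs y → y ∈ occPosAux v k xs → Σ ℕ λ i → i < length xs × y ≡ k + suc i × at xs i ≡ v
∈-occPosAux⁻ v k (x ∷ xs) y y∈ with x ≡ᵇ v in x≡v
∈-occPosAux⁻ v k (x ∷ xs) y (here refl) | true = 0 , z<s , +-comm 1 k , ≡ᵇ-true⇒≡ x≡v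
∈-occPosAux⁻ v k (x ∷ xs) y (there y∈)  | true with ∈-occPosAux⁻ v (suc k) xs y y∈
... | i , i<n , refl , xs[i] = suc i , s≤s i<n , sym (+-suc k (suc i)) , xs[i]
∈-occPosAux⁻ v k (x ∷ xs) y y∈ | false with ∈-occPosAux⁻ v (suc k) xs y y∈
... | i , i<n , refl , xs[i] = suc i , s≤s i<n , sym (+-suc k (suc i)) , xs[i]

∈-occPosAux⁺ : ∀ v k xs i → i < length xs → at xs i ≡ v → k + suc i ∈ occPosAux v k xs
∈-occPosAux⁺ v k (x ∷ xs) zero _ x≡v rewrite ≡⇒≡ᵇ-true x≡v = here (+-comm k 1)
∈-occPosAux⁺ v k (x ∷ xs) (suc i) (s≤s i<n) xs[i] with x ≡ᵇ v
... | true  = there rec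
  where rec = subst (_∈ occPosAux v (suc k) xs) (sym (+-suc k (suc i))) (∈-occPosAux⁺ v (suc k) xs i i<n xs[i])
... | false = subst (_∈ occPosAux v (suc k) xs) (sym (+-suc k (suc i))) (∈-occPosAux⁺ v (suc k) xs i i<n xs[i])

occPosAux-increasing : ∀ v k xs → Increasing (occPosAux v k xs)
occPosAux-increasing v k []       = []
occPosAux-increasing v k (x ∷ xs) with x ≡ᵇ v
... | true  = All.tabulate k<tail ∷ occPosAux-increasing v (suc k) xs
  where
  k<tail : ∀ {y} → y ∈ occPosAux v (suc k) xs → suc k < y
  k<tail {y} y∈ with ∈-occPosAux⁻ v (suc k) xs y y∈
  ... | _ , _ , refl , _ = m<m+n (suc k) z<s
... | false = occPosAux-increasing v (suc k) xs

∈-occPos⁻ : ∀ v s y → y ∈ occPos v s → Σ ℕ λ i → i < length s × y ≡ suc i × at s i ≡ v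
∈-occPos⁻ v = ∈-occPosAux⁻ v 0

∈-occPos⁺ : ∀ v s i → i < length s → at s i ≡ v → suc i ∈ occPos v s
∈-occPos⁺ v = ∈-occPosAux⁺ v 0

occPos-increasing : ∀ v s → Increasing (occPos v s)
occPos-increasing v = occPosAux-increasing v 0

LastTwo : List ℕ → ℕ → ℕ → Set
LastTwo L a b = a ∈ L × b ∈ L × a < b × (∀ y → y ∈ L → y ≤ a ⊎ y ≡ b)

sebrAux-lastTwo : ∀ s {L a b} → Increasing L → LastTwo L a b → sebrAux s L ≡ minBetween s a b
sebrAux-lastTwo s {x ∷ []} _ (here refl , here refl , a<b , _) = ⊥-elim (<-irrefl refl a<b)
sebrAux-lastTwo s {x ∷ y ∷ []} ((x<y ∷ []) ∷ _) (a∈ , b∈ , a<b , _) with a∈ | b∈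
... | here refl         | there (here refl) = refl
... | here refl         | here refl         = ⊥-elim (<-irrefl refl a<b)
... | there (here refl) | here refl         = ⊥-elim (<-asym a<b x<y)
... | there (here refl) | there (here refl) = ⊥-elim (<-irrefl refl a<b)
sebrAux-lastTwo s {x ∷ y ∷ z ∷ ps} ((x<y ∷ x<z ∷ _) ∷ (y<z ∷ _) ∷ _) (here refl , _ , _ , top)
  with top y (there (here refl)) | top z (there (there (here refl)))
... | inj₁ y≤x | _        = ⊥-elim (<⇒≱ x<y y≤x)
... | inj₂ _   | inj₁ z≤x = ⊥-elim (<⇒≱ x<z z≤x)
... | inj₂ y≡b | inj₂ z≡b = ⊥-elim (<-irrefl (trans y≡b (sym z≡b)) y<z)
sebrAux-lastTwo s {x ∷ y ∷ z ∷ ps} (x< ∷ _) (there a∈ , here refl , a<b , _) =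
  ⊥-elim (<⇒≱ a<b (<⇒≤ (All.lookup x< a∈)))
sebrAux-lastTwo s {x ∷ y ∷ z ∷ ps} (_ ∷ L↑) (there a∈ , there b∈ , a<b , top) =
  sebrAux-lastTwo s L↑ (a∈ , b∈ , a<b , λ w w∈ → top w (there w∈))

sebrAux≢0⇒lastTwo : ∀ s {L} → Increasing L → sebrAux s L ≢ 0 → Σ ℕ λ a → Σ ℕ λ b → LastTwo L a b
sebrAux≢0⇒lastTwo s {[]}         _ ≢0 = ⊥-elim (≢0 refl)
sebrAux≢0⇒lastTwo s {a ∷ []}     _ ≢0 = ⊥-elim (≢0 refl)
sebrAux≢0⇒lastTwo s {a ∷ b ∷ []} ((a<b ∷ []) ∷ _) _ = a , b , here refl , there (here refl) , a<b , top
  where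
  top : ∀ y → y ∈ a ∷ b ∷ [] → y ≤ a ⊎ y ≡ b
  top y (here refl)         = inj₁ ≤-refl
  top y (there (here refl)) = inj₂ refl
sebrAux≢0⇒lastTwo s {x ∷ y ∷ z ∷ ps} (x< ∷ L↑) ≢0 with sebrAux≢0⇒lastTwo s L↑ ≢0
... | a , b , a∈ , b∈ , a<b , top = a , b , there a∈ , there b∈ , a<b , top′
  where
  top′ : ∀ w → w ∈ x ∷ y ∷ z ∷ ps → w ≤ a ⊎ w ≡ b
  top′ w (here refl) = inj₁ (<⇒≤ (All.lookup x< a∈))
  top′ w (there w∈)  = top w w∈

minList-≤ : ∀ xs y → y ∈ xs → minList xs ≤ y
minList-≤ (x ∷ xs) y y∈ = go x xs y y∈
  where
  go : ∀ x xs y → y ∈ x ∷ xs → foldr _⊓_ x xs ≤ y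
  go x []       y (here refl)         = ≤-refl
  go x (z ∷ xs) y (here refl)         = ≤-trans (m⊓n≤n z _) (go x xs x (here refl))
  go x (z ∷ xs) y (there (here refl)) = m⊓n≤m z _
  go x (z ∷ xs) y (there (there y∈))  = ≤-trans (m⊓n≤n z _) (go x xs y (there y∈))

minList-∈ : ∀ xs → 0 < length xs → minList xs ∈ xs
minList-∈ (x ∷ xs) _ = go x xs
  where
  go : ∀ x xs → foldr _⊓_ x xs ∈ x ∷ xs
  go x []       = here refl
  go x (y ∷ xs) with ⊓-sel y (foldr _⊓_ x xs)
  ... | inj₁ e = there (here e)
  ... | inj₂ e rewrite e with go x xs
  ...   | here e′  = here e′
  ...   | there m′ = there (there m′)

minList-≡ : ∀ xs w → w ∈ xs → (∀ y → y ∈ xs → w ≤ y) → minList xs ≡ w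
minList-≡ xs w w∈ w≤ = ≤-antisym (minList-≤ xs w w∈) (w≤ _ (minList-∈ xs (nonempty w∈)))
  where
  nonempty : ∀ {xs} → w ∈ xs → 0 < length xs
  nonempty (here _)  = z<s
  nonempty (there _) = z<s

minList≢0⇒∈ : ∀ xs → minList xs ≢ 0 → minList xs ∈ xs
minList≢0⇒∈ []       ≢0 = ⊥-elim (≢0 refl)
minList≢0⇒∈ (x ∷ xs) _  = minList-∈ (x ∷ xs) z<s

-- the entries strictly between the 0-based positions q and p: the window of minBetween s (suc q) (suc p)
Between : List ℕ → ℕ → ℕ → List ℕ
Between s q p = take (p ∸ suc q) (drop (suc q) s)

∈-Between⁻ : ∀ s q p y → q < p → y ∈ Between s q p → Σ ℕ λ k → q < k × k < p × k < length s × at s k ≡ y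
∈-Between⁻ s q p y q<p y∈ with ∈⇒at (Between s q p) y∈
... | i , i<n , e = suc q + i , s≤s (m≤m+n q i) , k<p , index-drop s (suc q) i i<drop ,
      trans (sym (at-drop s (suc q) i)) (trans (sym (at-take (drop (suc q) s) (p ∸ suc q) i i<m)) e)
  where
  i<min : i < (p ∸ suc q) ⊓ length (drop (suc q) s)
  i<min = subst (i <_) (List.length-take (p ∸ suc q) (drop (suc q) s)) i<n
  i<m = <-≤-trans i<min (m⊓n≤m _ _)
  i<drop = <-≤-trans i<min (m⊓n≤n _ _)
  k<p : suc q + i < p
  k<p = <-≤-trans (+-monoʳ-< (suc q) i<m) (≤-reflexive (m+[n∸m]≡n q<p))

∈-Between⁺ : ∀ s q p k → q < k → k < p → k < length s → at s k ∈ Between s q p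
∈-Between⁺ s q p k q<k k<p k<n = subst (_∈ Between s q p) e (at-∈ _ (k ∸ suc q) i<n)
  where
  i<m : k ∸ suc q < p ∸ suc q
  i<m = ∸-monoˡ-< k<p q<k
  i<n : k ∸ suc q < length (Between s q p)
  i<n = subst (k ∸ suc q <_) (sym (List.length-take (p ∸ suc q) (drop (suc q) s)))
          (⊓-glb i<m (subst (k ∸ suc q <_) (sym (List.length-drop (suc q) s)) (∸-monoˡ-< k<n q<k)))
  e : at (Between s q p) (k ∸ suc q) ≡ at s k
  e = trans (at-take (drop (suc q) s) (p ∸ suc q) (k ∸ suc q) i<m)
            (trans (at-drop s (suc q) (k ∸ suc q)) (cong (at s) (m+[n∸m]≡n q<k)))

-- Ascents and ascent sequences

asc-take-mono : ∀ s j k → j ≤ k → asc (take j s) ≤ asc (take k s)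
asc-take-mono s           zero          k             _               = z≤n
asc-take-mono []          (suc j)       (suc k)       _               = z≤n
asc-take-mono (x ∷ [])    (suc zero)    (suc k)       _               = z≤n
asc-take-mono (x ∷ [])    (suc (suc j)) (suc (suc k)) _               = z≤n
asc-take-mono (x ∷ [])    (suc (suc j)) (suc zero)    (s≤s ())
asc-take-mono (x ∷ y ∷ s) (suc zero)    (suc k)       _               = z≤n
asc-take-mono (x ∷ y ∷ s) (suc (suc j)) (suc (suc k)) (s≤s (s≤s j≤k)) =
  +-monoʳ-≤ (b2n (x <ᵇ y)) (asc-take-mono (y ∷ s) (suc j) (suc k) (s≤s j≤k))

asc-take-suc : ∀ s i → 1 ≤ i → i < length s →
               asc (take (suc i) s) ≡ asc (take i s) + b2n (at s (i ∸ 1) <ᵇ at s i)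
asc-take-suc (x ∷ [])    (suc zero)    _ (s≤s ())
asc-take-suc (x ∷ y ∷ s) (suc zero)    _ _          = +-comm (b2n (x <ᵇ y)) 0
asc-take-suc (x ∷ y ∷ s) (suc (suc i)) _ (s≤s i<n) =
  trans (cong (b2n (x <ᵇ y) +_) (asc-take-suc (y ∷ s) (suc i) (s≤s z≤n) i<n))
        (sym (+-assoc (b2n (x <ᵇ y)) _ _))

asc≤length∸1 : ∀ xs → asc xs ≤ length xs ∸ 1
asc≤length∸1 []          = z≤n
asc≤length∸1 (x ∷ [])    = z≤n
asc≤length∸1 (x ∷ y ∷ l) = +-mono-≤ (b2n≤1 (x <ᵇ y)) (asc≤length∸1 (y ∷ l))

asc-take≤ : ∀ s k → k ≤ length s → asc (take k s) ≤ k ∸ 1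
asc-take≤ s k k≤n = subst (λ z → asc (take k s) ≤ z ∸ 1)
  (trans (List.length-take k s) (m≤n⇒m⊓n≡m k≤n)) (asc≤length∸1 (take k s))

take-length : ∀ (xs : List ℕ) → take (length xs) xs ≡ xs
take-length []       = refl
take-length (x ∷ xs) = cong (x ∷_) (take-length xs)

asc-≔ : ∀ xs p w → 1 ≤ p → p < length xs →
        (at xs (p ∸ 1) <ᵇ at xs p) ≡ (at xs (p ∸ 1) <ᵇ w) →
        (suc p < length xs → (at xs p <ᵇ at xs (suc p)) ≡ (w <ᵇ at xs (suc p))) →
        asc (xs [ p ]≔ w) ≡ asc xs
asc-≔ (x ∷ [])        (suc zero)    w _ (s≤s ())  left right
asc-≔ (x ∷ y ∷ [])    (suc zero)    w _ _         left right = cong (_+ 0) (cong b2n (sym left))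
asc-≔ (x ∷ y ∷ z ∷ l) (suc zero)    w _ _         left right =
  cong₂ _+_ (cong b2n (sym left)) (cong (_+ asc (z ∷ l)) (cong b2n (sym (right (s≤s (s≤s z<s))))))
asc-≔ (x ∷ y ∷ l)     (suc (suc p)) w _ (s≤s p<n) left right =
  cong (b2n (x <ᵇ y) +_) (asc-≔ (y ∷ l) (suc p) w (s≤s z≤n) p<n left (right ∘′ s≤s))

ascent-< : ∀ {s} → IsAscent s → ∀ k → k < length s → at s k < suc k
ascent-< s↑ k k<n = proj₁ (s↑ k k<n)

ascent-≤ : ∀ {s} → IsAscent s → ∀ k → k < length s → 1 ≤ k → at s k ≤ asc (take k s) + 1
ascent-≤ s↑ k k<n = proj₂ (s↑ k k<n)

ascent-entry≤asc : ∀ {s} → IsAscent s → ∀ i → i < length s → at s i ≤ asc (take (suc i) s)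
ascent-entry≤asc {x ∷ s} s↑ zero i<n = ≤-pred (ascent-< s↑ 0 i<n)
ascent-entry≤asc {s} s↑ (suc i) i<n with at s (suc i) ≤? asc (take (suc i) s)
... | yes ≤asc = ≤-trans ≤asc (asc-take-mono s (suc i) (suc (suc i)) (n≤1+n _))
... | no ≰asc = ≤-reflexive (sym asc≡)
  where
  top : at s (suc i) ≡ asc (take (suc i) s) + 1
  top = ≤-antisym (ascent-≤ s↑ (suc i) i<n (s≤s z≤n)) (subst (_≤ at s (suc i)) (+-comm 1 _) (≰⇒> ≰asc))
  rise : (at s i <ᵇ at s (suc i)) ≡ true
  rise = <⇒<ᵇ-true (≤-trans (s≤s (ascent-entry≤asc s↑ i (<-trans (n<1+n i) i<n)))
                             (≤-reflexive (trans (+-comm 1 _) (sym top))))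
  asc≡ : asc (take (suc (suc i)) s) ≡ at s (suc i)
  asc≡ = trans (asc-take-suc s (suc i) (s≤s z≤n) i<n)
               (trans (cong (λ b → asc (take (suc i) s) + b2n b) rise) (sym top))

ascent-fixed⇒asc : ∀ {s} → IsAscent s → ∀ i → i < length s → at s i ≡ i → asc (take (suc i) s) ≡ i
ascent-fixed⇒asc {x ∷ s} s↑ zero    _   _     = refl
ascent-fixed⇒asc {s}     s↑ (suc i) i<n fixed = begin
  asc (take (suc (suc i)) s)                               ≡⟨ asc-take-suc s (suc i) (s≤s z≤n) i<n ⟩
  asc (take (suc i) s) + b2n (at s i <ᵇ at s (suc i))      ≡⟨ cong₂ (λ a b → a + b2n b) asc≡i rise ⟩
  i + 1                                                    ≡⟨ +-comm i 1 ⟩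
  suc i                                                    ∎
  where
  open ≡-Reasoning
  asc≡i : asc (take (suc i) s) ≡ i
  asc≡i = ≤-antisym (asc-take≤ s (suc i) (<⇒≤ i<n))
                    (≤-pred (subst (_≤ suc (asc (take (suc i) s))) fixed
                                   (subst (at s (suc i) ≤_) (+-comm _ 1) (ascent-≤ s↑ (suc i) i<n (s≤s z≤n)))))
  rise : (at s i <ᵇ at s (suc i)) ≡ true
  rise = <⇒<ᵇ-true (subst (at s i <_) (sym fixed) (ascent-< s↑ i (<-trans (n<1+n i) i<n)))

ascent-asc⇒fixed : ∀ {s} → IsAscent s → ∀ i → i < length s → asc (take (suc i) s) ≡ i → ∀ j → j ≤ i → at s j ≡ j
ascent-asc⇒fixed s↑ zero i<n _ zero z≤n = n<1⇒n≡0 (ascent-< s↑ 0 i<n)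
ascent-asc⇒fixed {s} s↑ (suc i) i<n asc≡ j j≤i with split-sum (trans (sym (asc-take-suc s (suc i) (s≤s z≤n) i<n)) asc≡)
                                                             (asc-take≤ s (suc i) (<⇒≤ i<n))
  where
  split-sum : ∀ {a b} → a + b2n b ≡ suc i → a ≤ i → (b ≡ true) × (a ≡ i)
  split-sum {a} {true}  e _   = refl , suc-injective (trans (+-comm 1 a) e)
  split-sum {a} {false} e a≤i = ⊥-elim (1+n≰n (subst (_≤ i) (trans (sym (+-identityʳ a)) e) a≤i))
... | rise , asc≡i with m≤n⇒m<n∨m≡n j≤i
...   | inj₁ j<1+i = prefix j (≤-pred j<1+i)
  where prefix = ascent-asc⇒fixed s↑ i (<-trans (n<1+n i) i<n) asc≡i
...   | inj₂ refl = ≤-antisym (≤-pred (ascent-< s↑ (suc i) i<n))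
                      (subst (_< at s (suc i)) (ascent-asc⇒fixed s↑ i (<-trans (n<1+n i) i<n) asc≡i i ≤-refl) (<ᵇ-true⇒< rise))

ascent-fixed-prefix : ∀ {s} → IsAscent s → ∀ i → i < length s → at s i ≡ i → ∀ j → j ≤ i → at s j ≡ j
ascent-fixed-prefix s↑ i i<n fixed = ascent-asc⇒fixed s↑ i i<n (ascent-fixed⇒asc s↑ i i<n fixed)

maxsAux-≡ : ∀ c xs K → K ≤ length xs → (∀ i → i < K → at xs i ≡ c + i) →
            (∀ i → K ≤ i → i < length xs → at xs i ≢ c + i) → maxsAux c xs ≡ K
maxsAux-≡ c []       zero    _         _     _     = refl
maxsAux-≡ c (x ∷ xs) zero    _         _     other
  rewrite ≢⇒≡ᵇ-false (subst (x ≢_) (+-identityʳ c) (other 0 z≤n z<s)) =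
  maxsAux-≡ (suc c) xs 0 z≤n (λ _ ()) (λ i _ i<n e → other (suc i) z≤n (s≤s i<n) (trans e (sym (+-suc c i))))
maxsAux-≡ c (x ∷ xs) (suc K) (s≤s K≤n) fixed other
  rewrite ≡⇒≡ᵇ-true (trans (fixed 0 z<s) (+-identityʳ c)) =
  cong suc (maxsAux-≡ (suc c) xs K K≤n (λ i i<K → trans (fixed (suc i) (s≤s i<K)) (+-suc c i))
                                        (λ i K≤i i<n e → other (suc i) (s≤s K≤i) (s≤s i<n) (trans e (sym (+-suc c i)))))

maxsAux-≔ : ∀ c xs p w → at xs p ≢ c + p → w ≢ c + p → maxsAux c (xs [ p ]≔ w) ≡ maxsAux c xs
maxsAux-≔ c []       p       w _   _   = refl
maxsAux-≔ c (x ∷ xs) zero    w x≢c w≢c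
  rewrite ≢⇒≡ᵇ-false (subst (x ≢_) (+-identityʳ c) x≢c) | ≢⇒≡ᵇ-false (subst (w ≢_) (+-identityʳ c) w≢c) = refl
maxsAux-≔ c (x ∷ xs) (suc p) w x≢c w≢c = cong (b2n (x ≡ᵇ c) +_)
  (maxsAux-≔ (suc c) xs p w (λ e → x≢c (trans e (sym (+-suc c p)))) (λ e → w≢c (trans e (sym (+-suc c p)))))

first-nonfixed : ∀ s → (∀ i → i < length s → at s i ≡ i) ⊎
                 (Σ ℕ λ K → K < length s × (∀ i → i < K → at s i ≡ i) × at s K ≢ K)
first-nonfixed s = go (length s) ≤-refl
  where
  go : ∀ m → m ≤ length s → (∀ i → i < m → at s i ≡ i) ⊎
       (Σ ℕ λ K → K < length s × (∀ i → i < K → at s i ≡ i) × at s K ≢ K)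
  go zero    _   = inj₁ (λ _ ())
  go (suc m) m<n with go m (<⇒≤ m<n)
  ... | inj₂ found = inj₂ found
  ... | inj₁ fixed with at s m ≟ m
  ...   | no  s[m]≢m = inj₂ (m , m<n , fixed , s[m]≢m)
  ...   | yes s[m]≡m = inj₁ fixed′
    where
    fixed′ : ∀ i → i < suc m → at s i ≡ i
    fixed′ i i<1+m with m≤n⇒m<n∨m≡n (≤-pred i<1+m)
    ... | inj₁ i<m  = fixed i i<m
    ... | inj₂ refl = s[m]≡m

-- in an ascent sequence the fixed points s_i = i - 1 form an initial segment, so max s is its length
maxs-first-nonfixed : ∀ {s} → IsAscent s → s ≢ upTo (length s) →
                      Σ ℕ λ K → K < length s × (∀ i → i < K → at s i ≡ i) × at s K ≢ K × maxs s ≡ K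
maxs-first-nonfixed {s} s↑ s≢id with first-nonfixed s
... | inj₁ fixed = ⊥-elim (s≢id (at-extensionality s (upTo (length s)) (sym (List.length-upTo (length s)))
                                  (λ k k<n → trans (fixed k k<n) (sym (at-upTo (length s) k k<n)))))
... | inj₂ (K , K<n , fixed , s[K]≢K) = K , K<n , fixed , s[K]≢K , maxsAux-≡ 0 s K (<⇒≤ K<n) fixed other
  where
  other : ∀ i → K ≤ i → i < length s → at s i ≢ i
  other i K≤i i<n s[i]≡i = s[K]≢K (ascent-fixed-prefix s↑ i i<n s[i]≡i K K≤i)

ealm-at : ∀ s K → maxs s ≡ K → K < length s → ealm s ≡ at s K
ealm-at s K refl K<n rewrite ≢⇒≡ᵇ-false (<⇒≢ K<n) | m+n∸n≡m K 1 = refl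

lastSat-< : ∀ (f : ℕ → Bool) K → 0 < K → lastSat f K < K
lastSat-< f (suc K) _ with f K
... | true  = ≤-refl
... | false with K
...   | zero    = ≤-refl
...   | suc K′ = <-trans (lastSat-< f (suc K′) z<s) ≤-refl

lastSat-maximal : ∀ (f : ℕ → Bool) K m → lastSat f K < m → m < K → f m ≡ false
lastSat-maximal f (suc K) m last<m m<1+K with f K in fK
... | true  = ⊥-elim (<⇒≱ last<m (≤-pred m<1+K))
... | false with m≤n⇒m<n∨m≡n (≤-pred m<1+K)
...   | inj₂ refl = fK
...   | inj₁ m<K  = lastSat-maximal f K m last<m m<K

lastSat-false : ∀ (f : ℕ → Bool) K → f (lastSat f K) ≡ false → ∀ m → m < K → f m ≡ false
lastSat-false f (suc K) f[last] m m<1+K with f K in fK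
... | true  = ⊥-elim (subst T (trans (sym fK) f[last]) _)
... | false with m≤n⇒m<n∨m≡n (≤-pred m<1+K)
...   | inj₂ refl = fK
...   | inj₁ m<K  = lastSat-false f K f[last] m m<K

lastSat-≡ : ∀ (f : ℕ → Bool) K k → f k ≡ true → k < K → (∀ m → k < m → m < K → f m ≡ false) → lastSat f K ≡ k
lastSat-≡ f (suc K) k fk k<1+K above with m≤n⇒m<n∨m≡n (≤-pred k<1+K)
... | inj₂ refl rewrite fk = refl
... | inj₁ k<K  rewrite above K k<K ≤-refl = lastSat-≡ f K k fk k<K (λ m k<m m<K → above m k<m (<-trans m<K ≤-refl))

lastSat-none : ∀ (f : ℕ → Bool) K → (∀ m → m < K → f m ≡ false) → lastSat f K ≡ 0
lastSat-none f zero    _    = refl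
lastSat-none f (suc K) none rewrite none K ≤-refl = lastSat-none f K (λ m m<K → none m (<-trans m<K ≤-refl))

rpos-unfold : ∀ s → rmin s ≢ length s → rpos s ≡ lastSat (rposCond s) (rmin s)
rpos-unfold s rmin≢n with rmin s ≡ᵇ length s in e
... | true  = ⊥-elim (rmin≢n (≡ᵇ-true⇒≡ e))
... | false = refl

rpos-all-rmin : ∀ s → rmin s ≡ length s → rpos s ≡ 0
rpos-all-rmin s e rewrite ≡⇒≡ᵇ-true e = refl

rpos<length-Prm : ∀ s → rmin s ≢ length s → 0 < rmin s → rpos s < length (Prm s)
rpos<length-Prm s rmin≢n 0<rmin = subst₂ _<_ (sym (rpos-unfold s rmin≢n)) (rmin≡length-Prm s)
                                     (lastSat-< (rposCond s) (rmin s) 0<rmin)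

-- lastSat defaults to 0 when no index qualifies, hence the hypothesis for rpos s ≡ 0
rposCond-rpos : ∀ s → rmin s ≢ length s → (rpos s ≡ 0 → rposCond s 0 ≡ true) → rposCond s (rpos s) ≡ true
rposCond-rpos s rmin≢n cond0 with rposCond s (rpos s) in e
... | true  = refl
... | false = ⊥-elim (subst T (trans (sym (cond0 rpos≡0)) (subst (λ z → rposCond s z ≡ false) rpos≡0 e)) _)
  where
  none : ∀ m → m < rmin s → rposCond s m ≡ false
  none = lastSat-false (rposCond s) (rmin s) (subst (λ z → rposCond s z ≡ false) (rpos-unfold s rmin≢n) e)
  rpos≡0 : rpos s ≡ 0
  rpos≡0 = trans (rpos-unfold s rmin≢n) (lastSat-none (rposCond s) (rmin s) none)

rpos≢0⇒ : ∀ s → rpos s ≢ 0 → rmin s ≢ length s × 0 < rmin s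
rpos≢0⇒ s rpos≢0 = rmin≢n , 0<rmin
  where
  rmin≢n : rmin s ≢ length s
  rmin≢n e = rpos≢0 (rpos-all-rmin s e)
  0<rmin : 0 < rmin s
  0<rmin = n≢0⇒n>0 (λ rmin≡0 → rpos≢0 (trans (rpos-unfold s rmin≢n) (cong (lastSat (rposCond s)) rmin≡0)))

lastIsMasc⇒ : ∀ xs m → length xs ≡ suc m → LastIsMasc xs → at xs m ≡ asc (take m xs) + 1
lastIsMasc⇒ xs m e masc rewrite e = masc

⇒lastIsMasc : ∀ xs m → length xs ≡ suc m → at xs m ≡ asc (take m xs) + 1 → LastIsMasc xs
⇒lastIsMasc xs m e masc rewrite e = masc

-- a repeated value cannot be an 𝓜asc: it is bounded by an earlier asc count
repeat⇒¬lastIsMasc : ∀ {xs} → IsAscent xs → ∀ i m → i < m → length xs ≡ suc m → at xs m ≡ at xs i → ¬ LastIsMasc xs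
repeat⇒¬lastIsMasc {xs} xs↑ i m i<m n≡ repeat masc = 1+n≰n (begin
  1 + asc (take m xs)   ≡⟨ +-comm 1 _ ⟩
  asc (take m xs) + 1   ≡⟨ trans (sym (lastIsMasc⇒ xs m n≡ masc)) repeat ⟩
  at xs i               ≤⟨ ascent-entry≤asc xs↑ i (<-trans i<m (subst (m <_) (sym n≡) ≤-refl)) ⟩
  asc (take (suc i) xs) ≤⟨ asc-take-mono xs (suc i) m i<m ⟩
  asc (take m xs)       ∎)
  where open ≤-Reasoning

asc-ending : ∀ xs m → length xs ≡ suc (suc m) →
             asc xs ≡ asc (take (suc m) xs) + b2n (at xs m <ᵇ at xs (suc m))
asc-ending xs m n≡ = begin
  asc xs                                                  ≡⟨ cong asc (sym (take-length xs)) ⟩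
  asc (take (length xs) xs)                               ≡⟨ cong (λ z → asc (take z xs)) n≡ ⟩
  asc (take (suc (suc m)) xs)                             ≡⟨ asc-take-suc xs (suc m) (s≤s z≤n) (subst (suc m <_) (sym n≡) ≤-refl) ⟩
  asc (take (suc m) xs) + b2n (at xs m <ᵇ at xs (suc m))  ∎
  where open ≡-Reasoning

length≥2 : ∀ (xs : List ℕ) → 2 ≤ length xs → Σ ℕ λ m → length xs ≡ suc (suc m)
length≥2 (x ∷ [])     (s≤s ())
length≥2 (x ∷ y ∷ xs) _ = length xs , refl

P₁⇒lastIsMasc : ∀ t → P₁ t → LastIsMasc t
P₁⇒lastIsMasc t (_ , 2≤n , rise , last≡asc) with length≥2 t 2≤n
... | m , n≡ = ⇒lastIsMasc t (suc m) n≡ (begin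
  at t (suc m)                                            ≡⟨ subst (λ z → entry t z ≡ asc t) n≡ last≡asc ⟩
  asc t                                                   ≡⟨ asc-ending t m n≡ ⟩
  asc (take (suc m) t) + b2n (at t m <ᵇ at t (suc m))     ≡⟨ cong (λ b → asc (take (suc m) t) + b2n b) (<⇒<ᵇ-true rise′) ⟩
  asc (take (suc m) t) + 1                                ∎)
  where
  open ≡-Reasoning
  rise′ : at t m < at t (suc m)
  rise′ = subst (λ z → entry t (z ∸ 1) < entry t z) n≡ rise

lastIsMasc⇒P₁ : ∀ t → AStar t → 2 ≤ length t → LastIsMasc t → P₁ t
lastIsMasc⇒P₁ t t* 2≤n masc with length≥2 t 2≤n
... | m , n≡ = t* , 2≤n , subst (λ z → entry t (z ∸ 1) < entry t z) (sym n≡) rise ,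
               subst (λ z → entry t z ≡ asc t) (sym n≡) (sym asc≡last)
  where
  last≡ : at t (suc m) ≡ asc (take (suc m) t) + 1
  last≡ = lastIsMasc⇒ t (suc m) n≡ masc
  rise : at t m < at t (suc m)
  rise = subst (at t m <_) (sym last≡) (subst (at t m <_) (+-comm 1 _)
           (s≤s (ascent-entry≤asc (proj₁ t*) m (subst (m <_) (sym n≡) (n≤1+n (suc m))))))
  asc≡last : asc t ≡ at t (suc m)
  asc≡last = trans (asc-ending t m n≡) (trans (cong (λ b → asc (take (suc m) t) + b2n b) (<⇒<ᵇ-true rise)) (sym last≡))

-- Raising the last occurrence of a right-to-left minimum

f₄ : List ℕ → List ℕ
f₄ s = s [ at (Prm s) (rpos s) ∸ 1 ]≔ sebr s

f₄⁻¹ : List ℕ → List ℕ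
f₄⁻¹ t = t [ at (Prm t) (rpos t) ∸ 1 ]≔ at (Rmin t) (rpos t ∸ 1)

-- positions are 0-based: s_q = s_p = v are the two rightmost occurrences of v, w = s_j is the
-- smallest entry between them, and t raises s_p from v to w
record Raise (s t : List ℕ) (q p v w : ℕ) : Set where
  field
    p<n     : p < length s
    q<p     : q < p
    t≡      : t ≡ s [ p ]≔ w
    s[q]≡v  : at s q ≡ v
    s[p]≡v  : at s p ≡ v
    v<w     : v < w
    j       : ℕ
    q<j     : q < j
    j<p     : j < p
    s[j]≡w  : at s j ≡ w
    between : ∀ k → q < k → k < p → w ≤ at s k
    after   : ∀ k → p < k → k < length s → w < at s k

module RaiseProperties {s t q p v w} (R : Raise s t q p v w) where
  open Raise R public

  length-t : length t ≡ length s
  length-t = trans (cong length t≡) (length-≔ s p w)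

  p<length-t : p < length t
  p<length-t = subst (p <_) (sym length-t) p<n

  t[p]≡w : at t p ≡ w
  t[p]≡w = trans (cong (λ z → at z p) t≡) (at-≔-same s p w p<n)

  t[k]≡s[k] : ∀ k → k ≢ p → at t k ≡ at s k
  t[k]≡s[k] k k≢p = trans (cong (λ z → at z k) t≡) (at-≔-other s p w k k≢p)

  t[q]≡v : at t q ≡ v
  t[q]≡v = trans (t[k]≡s[k] q (<⇒≢ q<p)) s[q]≡v

  t[j]≡w : at t j ≡ w
  t[j]≡w = trans (t[k]≡s[k] j (<⇒≢ j<p)) s[j]≡w

  v<s[k] : ∀ k → q < k → k < length s → k ≢ p → v < at s k
  v<s[k] k q<k k<n k≢p with <-cmp k p
  ... | tri< k<p _ _ = <-≤-trans v<w (between k q<k k<p)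
  ... | tri≈ _ k≡p _ = ⊥-elim (k≢p k≡p)
  ... | tri> _ _ p<k = <-trans v<w (after k p<k k<n)

  isRmin-s⇒t : ∀ i → IsRmin s i → IsRmin t i
  isRmin-s⇒t i rm k i<k k<n with i ≟ p | k ≟ p
  ... | yes refl | _        = subst₂ _<_ (sym t[p]≡w) (sym (t[k]≡s[k] k (≢-sym (<⇒≢ i<k))))
                                (after k i<k (subst (k <_) length-t k<n))
  ... | no i≢p   | yes refl = subst₂ _<_ (sym (t[k]≡s[k] i i≢p)) (sym t[p]≡w)
                                (<-trans (subst (at s i <_) s[p]≡v (rm p i<k p<n)) v<w)
  ... | no i≢p   | no k≢p   = subst₂ _<_ (sym (t[k]≡s[k] i i≢p)) (sym (t[k]≡s[k] k k≢p))
                                (rm k i<k (subst (k <_) length-t k<n))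

  isRmin-t⇒s : ∀ i → IsRmin t i → i ≢ q → IsRmin s i
  isRmin-t⇒s i rm i≢q k i<k k<n with i ≟ p
  ... | yes refl = subst (_< at s k) (sym s[p]≡v) (<-trans v<w (after k i<k k<n))
  ... | no i≢p with k ≟ p
  ...   | no k≢p = subst₂ _<_ (t[k]≡s[k] i i≢p) (t[k]≡s[k] k k≢p) (rm k i<k (subst (k <_) (sym length-t) k<n))
  ...   | yes refl with <-cmp i q
  ...     | tri< i<q _ _ = subst (at s i <_) (sym s[p]≡v)
                             (subst₂ _<_ (t[k]≡s[k] i i≢p) t[q]≡v (rm q i<q (subst (q <_) (sym length-t) (<-trans q<p p<n))))
  ...     | tri≈ _ i≡q _ = ⊥-elim (i≢q i≡q)
  ...     | tri> _ _ q<i = ⊥-elim (<⇒≱ (subst₂ _<_ (t[k]≡s[k] i i≢p) t[p]≡w (rm p i<k p<length-t)) (between i q<i i<k))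

  isRmin-t-q : IsRmin t q
  isRmin-t-q k q<k k<n with k ≟ p
  ... | yes refl = subst₂ _<_ (sym t[q]≡v) (sym t[p]≡w) v<w
  ... | no k≢p   = subst₂ _<_ (sym t[q]≡v) (sym (t[k]≡s[k] k k≢p)) (v<s[k] k q<k (subst (k <_) length-t k<n) k≢p)

  ¬isRmin-s-q : ¬ IsRmin s q
  ¬isRmin-s-q rm = <-irrefl (trans s[q]≡v (sym s[p]≡v)) (rm p q<p p<n)

  isRmin-s-p : IsRmin s p
  isRmin-s-p k p<k k<n = subst (_< at s k) (sym s[p]≡v) (<-trans v<w (after k p<k k<n))

  ∈-Prm-t⁻ : ∀ y → y ∈ Prm t → y ≡ suc q ⊎ y ∈ Prm s
  ∈-Prm-t⁻ y y∈ with ∈-Prm⁻ t y y∈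
  ... | i , refl , i<n , rm with i ≟ q
  ...   | yes refl = inj₁ refl
  ...   | no i≢q   = inj₂ (∈-Prm⁺ s i (subst (i <_) length-t i<n) (isRmin-t⇒s i rm i≢q))

  ∈-Prm-t⁺ : ∀ y → y ≡ suc q ⊎ y ∈ Prm s → y ∈ Prm t
  ∈-Prm-t⁺ y (inj₁ refl) = ∈-Prm⁺ t q (subst (q <_) (sym length-t) (<-trans q<p p<n)) isRmin-t-q
  ∈-Prm-t⁺ y (inj₂ y∈) with ∈-Prm⁻ s y y∈
  ... | i , refl , i<n , rm = ∈-Prm⁺ t i (subst (i <_) (sym length-t) i<n) (isRmin-s⇒t i rm)

  1+q∉Prm-s : ¬ (suc q ∈ Prm s)
  1+q∉Prm-s 1+q∈ with ∈-Prm⁻ s (suc q) 1+q∈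
  ... | _ , refl , _ , rm = ¬isRmin-s-q rm

  -- r is the index of p among the right-to-left minima of s; in t the new minimum q is inserted before it
  private
    split-at-q = increasing-split (Prm-increasing s) q

  r : ℕ
  r = proj₁ split-at-q

  r≤rmin : r ≤ length (Prm s)
  r≤rmin = proj₁ (proj₂ split-at-q)

  Prm-s-below : ∀ i → i < r → at (Prm s) i ≤ q
  Prm-s-below = proj₁ (proj₂ (proj₂ split-at-q))

  Prm-s-above : ∀ i → r ≤ i → i < length (Prm s) → suc q < at (Prm s) i
  Prm-s-above i r≤i i<P with m≤n⇒m<n∨m≡n (proj₂ (proj₂ (proj₂ split-at-q)) i r≤i i<P)
  ... | inj₁ 1+q<P[i] = 1+q<P[i]
  ... | inj₂ 1+q≡P[i] = ⊥-elim (1+q∉Prm-s (subst (_∈ Prm s) (sym 1+q≡P[i]) (at-∈ (Prm s) i i<P)))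

  Prm-s[r] : at (Prm s) r ≡ suc p × r < length (Prm s)
  Prm-s[r] with ∈⇒at (Prm s) (∈-Prm⁺ s p p<n isRmin-s-p)
  ... | k , k<P , P[k] with <-cmp k r
  ...   | tri< k<r _ _  = ⊥-elim (<⇒≱ q<p (<⇒≤ (subst (_≤ q) P[k] (Prm-s-below k k<r))))
  ...   | tri≈ _ refl _ = P[k] , k<P
  ...   | tri> _ _ r<k with at-Prm s r (<-trans r<k k<P)
  ...     | i , P[r] , _ , rm = ⊥-elim (<⇒≱ (rm p i<p p<n) (≤-trans (<⇒≤ (subst (_< w) (sym s[p]≡v) v<w)) (between i q<i i<p)))
    where
    q<i : q < i
    q<i = ≤-pred (subst (suc q <_) P[r] (Prm-s-above r ≤-refl (<-trans r<k k<P)))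
    i<p : i < p
    i<p = ≤-pred (subst₂ _<_ P[r] P[k] (increasing⇒at-< (Prm-increasing s) r k r<k k<P))

  r<rmin : r < length (Prm s)
  r<rmin = proj₂ Prm-s[r]

  Prm-t≡ : Prm t ≡ insertAt (Prm s) r (suc q)
  Prm-t≡ = increasing-sameMembers⇒≡ (Prm-increasing t)
    (increasing-insertAt (Prm-increasing s) r (suc q) r≤rmin (λ i i<r → s≤s (Prm-s-below i i<r)) Prm-s-above)
    (λ y y∈ → ∈-insertAt⁺ (Prm s) r (suc q) (∈-Prm-t⁻ y y∈)) (λ y y∈ → ∈-Prm-t⁺ y (∈-insertAt⁻ (Prm s) r (suc q) y∈))

  length-Prm-t : length (Prm t) ≡ suc (length (Prm s))
  length-Prm-t = trans (cong length Prm-t≡) (length-insertAt (Prm s) r (suc q) r≤rmin)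

  rmin-t≡ : rmin t ≡ suc (rmin s)
  rmin-t≡ = trans (rmin≡length-Prm t) (trans length-Prm-t (cong suc (sym (rmin≡length-Prm s))))

  Prm-t[r] : at (Prm t) r ≡ suc q
  Prm-t[r] = trans (cong (λ z → at z r) Prm-t≡) (at-insertAt-≡ (Prm s) r (suc q) r≤rmin)

  Prm-t-> : ∀ i → r ≤ i → at (Prm t) (suc i) ≡ at (Prm s) i
  Prm-t-> i r≤i = trans (cong (λ z → at z (suc i)) Prm-t≡) (at-insertAt-> (Prm s) r (suc q) i r≤rmin r≤i)

  Prm-t[1+r] : at (Prm t) (suc r) ≡ suc p
  Prm-t[1+r] = trans (Prm-t-> r ≤-refl) (proj₁ Prm-s[r])

  Prm-s≢1+p : ∀ i → i ≢ r → i < length (Prm s) → at (Prm s) i ∸ 1 ≢ p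
  Prm-s≢1+p i i≢r i<P P[i]∸1≡p with at-Prm s i i<P
  ... | _ , P[i] , _ rewrite P[i] = i≢r (increasing⇒at-injective (Prm-increasing s) i r i<P r<rmin
                                          (trans P[i] (trans (cong suc P[i]∸1≡p) (sym (proj₁ Prm-s[r])))))

  rminValue-s-r : rminValue s r ≡ v
  rminValue-s-r = trans (cong (λ z → at s (z ∸ 1)) (proj₁ Prm-s[r])) s[p]≡v

  rminValue-t-r : rminValue t r ≡ v
  rminValue-t-r = trans (cong (λ z → at t (z ∸ 1)) Prm-t[r]) t[q]≡v

  rminValue-t-1+r : rminValue t (suc r) ≡ w
  rminValue-t-1+r = trans (cong (λ z → at t (z ∸ 1)) Prm-t[1+r]) t[p]≡w

  rminValue-t-> : ∀ i → r < i → i < length (Prm s) → rminValue t (suc i) ≡ rminValue s i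
  rminValue-t-> i r<i i<P = trans (cong (λ z → at t (z ∸ 1)) (Prm-t-> i (<⇒≤ r<i)))
                                  (t[k]≡s[k] _ (Prm-s≢1+p i (≢-sym (<⇒≢ r<i)) i<P))

  rposCond-t-shift : ∀ m → r < m → m < length (Prm s) → rposCond t (suc m) ≡ rposCond s m
  rposCond-t-shift (suc m) r<1+m 1+m<P = cong₂ (λ a b → 1 <ᵇ occ a b)
    (trans (at-Rmin t (suc (suc m)) (subst (suc (suc m) <_) (sym length-Prm-t) (s≤s 1+m<P)))
      (trans (rminValue-t-> (suc m) r<1+m 1+m<P) (sym (at-Rmin s (suc m) 1+m<P))))
    (trans (cong (λ z → drop z t) (Prm-t-> m (≤-pred r<1+m)))
      (trans (cong (drop (at (Prm s) m)) t≡) (drop-≔ s p w (at (Prm s) m) p<P[m])))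
    where
    p<P[m] : p < at (Prm s) m
    p<P[m] = subst (_≤ at (Prm s) m) (proj₁ Prm-s[r]) (increasing⇒at-≤ (Prm-increasing s) r m (≤-pred r<1+m) (<-trans ≤-refl 1+m<P))

  Rmin-s[r]≡v : at (Rmin s) r ≡ v
  Rmin-s[r]≡v = trans (at-Rmin s r r<rmin) rminValue-s-r

  rposCond-s-r : rposCond s r ≡ true
  rposCond-s-r = rposCond⁺ s r q p (afterRmin-intro s r q Prm-s-below) q<p p<n
                   (trans s[q]≡v (sym Rmin-s[r]≡v)) (trans s[p]≡v (sym Rmin-s[r]≡v))

  Rmin-t[1+r]≡w : at (Rmin t) (suc r) ≡ w
  Rmin-t[1+r]≡w = trans (at-Rmin t (suc r) (subst (suc r <_) (sym length-Prm-t) (s≤s r<rmin))) rminValue-t-1+r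

  rposCond-t-1+r : rposCond t (suc r) ≡ true
  rposCond-t-1+r = rposCond⁺ t (suc r) j p (subst (_≤ j) (sym Prm-t[r]) q<j) j<p p<length-t
                     (trans t[j]≡w (sym Rmin-t[1+r]≡w)) (trans t[p]≡w (sym Rmin-t[1+r]≡w))

  rmin-s≢length : rmin s ≢ length s
  rmin-s≢length e = ¬isRmin-s-q (length-Prm≡⇒isRmin s (trans (sym (rmin≡length-Prm s)) e) q (<-trans q<p p<n))

  rmin-t≢length : rmin t ≢ length t
  rmin-t≢length e = <-irrefl (trans t[j]≡w (sym t[p]≡w))
    (length-Prm≡⇒isRmin t (trans (sym (rmin≡length-Prm t)) e) j (<-trans j<p p<length-t) p j<p p<length-t)

  r<rmin-s : r < rmin s
  r<rmin-s = subst (r <_) (sym (rmin≡length-Prm s)) r<rmin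

  rpos-t≡ : rpos s ≡ r → rpos t ≡ suc r
  rpos-t≡ rpos≡r = trans (rpos-unfold t rmin-t≢length) (trans (cong (lastSat (rposCond t)) rmin-t≡)
    (lastSat-≡ (rposCond t) (suc (rmin s)) (suc r) rposCond-t-1+r (s≤s r<rmin-s) none))
    where
    none : ∀ m → suc r < m → m < suc (rmin s) → rposCond t m ≡ false
    none (suc m) 1+r<1+m 1+m<1+rmin =
      trans (rposCond-t-shift m (≤-pred 1+r<1+m) (subst (m <_) (rmin≡length-Prm s) (≤-pred 1+m<1+rmin)))
            (lastSat-maximal (rposCond s) (rmin s) m (subst (_< m) (trans (sym rpos≡r) (rpos-unfold s rmin-s≢length)) (≤-pred 1+r<1+m))
                             (≤-pred 1+m<1+rmin))

  rpos-s≡ : rpos t ≡ suc r → rpos s ≡ r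
  rpos-s≡ rpos≡1+r = trans (rpos-unfold s rmin-s≢length) (lastSat-≡ (rposCond s) (rmin s) r rposCond-s-r r<rmin-s none)
    where
    none : ∀ m → r < m → m < rmin s → rposCond s m ≡ false
    none m r<m m<rmin = trans (sym (rposCond-t-shift m r<m (subst (m <_) (rmin≡length-Prm s) m<rmin)))
      (lastSat-maximal (rposCond t) (rmin t) (suc m) (subst (_< suc m) (trans (sym rpos≡1+r) (rpos-unfold t rmin-t≢length)) (s≤s r<m))
                       (subst (suc m <_) (sym rmin-t≡) (s≤s m<rmin)))

  sebr-s≡w : rpos s ≡ r → sebr s ≡ w
  sebr-s≡w rpos≡r = begin
    sebrAux s (occPos (at (Rmin s) (rpos s)) s) ≡⟨ cong (λ z → sebrAux s (occPos z s)) (trans (cong (at (Rmin s)) rpos≡r) Rmin-s[r]≡v) ⟩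
    sebrAux s (occPos v s)                      ≡⟨ sebrAux-lastTwo s (occPos-increasing v s) lastTwo ⟩
    minList (Between s q p)                     ≡⟨ minList-≡ _ w w∈ w≤ ⟩
    w                                           ∎
    where
    open ≡-Reasoning
    lastTwo : LastTwo (occPos v s) (suc q) (suc p)
    lastTwo = ∈-occPos⁺ v s q (<-trans q<p p<n) s[q]≡v , ∈-occPos⁺ v s p p<n s[p]≡v , s≤s q<p , top
      where
      top : ∀ y → y ∈ occPos v s → y ≤ suc q ⊎ y ≡ suc p
      top y y∈ with ∈-occPos⁻ v s y y∈
      ... | i , i<n , refl , s[i]≡v with i ≤? q
      ...   | yes i≤q = inj₁ (s≤s i≤q)
      ...   | no i≰q with i ≟ p
      ...     | yes refl = inj₂ refl
      ...     | no i≢p   = ⊥-elim (<-irrefl (sym s[i]≡v) (v<s[k] i (≰⇒> i≰q) i<n i≢p))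
    w∈ : w ∈ Between s q p
    w∈ = subst (_∈ Between s q p) s[j]≡w (∈-Between⁺ s q p j q<j j<p (<-trans j<p p<n))
    w≤ : ∀ y → y ∈ Between s q p → w ≤ y
    w≤ y y∈ with ∈-Between⁻ s q p y q<p y∈
    ... | k , q<k , k<p , _ , refl = between k q<k k<p

  w<Rmin-s[1+r] : (suc r ≡ rmin s) ⊎ (w < at (Rmin s) (suc r))
  w<Rmin-s[1+r] with suc r <? length (Prm s)
  ... | no  1+r≮P = inj₁ (trans (≤-antisym r<rmin (≮⇒≥ 1+r≮P)) (sym (rmin≡length-Prm s)))
  ... | yes 1+r<P with at-Prm s (suc r) 1+r<P
  ...   | i , P[1+r] , i<n , _ = inj₂ (subst (w <_) (sym (at-Rmin s (suc r) 1+r<P))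
                                    (subst (λ z → w < at s (z ∸ 1)) (sym P[1+r]) (after i p<i i<n)))
    where
    p<i : p < i
    p<i = ≤-pred (subst₂ _<_ (proj₁ Prm-s[r]) P[1+r] (increasing⇒at-< (Prm-increasing s) r (suc r) ≤-refl 1+r<P))

  asc-take-t≡s : ∀ k → asc (take k t) ≡ asc (take k s)
  asc-take-t≡s k with k ≤? p
  ... | yes k≤p = cong asc (trans (cong (take k) t≡) (trans (take-≔ s p w k)
                    (≔-beyond (take k s) p w (≤-trans (≤-reflexive (List.length-take k s)) (≤-trans (m⊓n≤m k _) k≤p)))))
  ... | no k≰p = trans (cong asc (trans (cong (take k) t≡) (take-≔ s p w k)))
                   (asc-≔ (take k s) p w (<-≤-trans z<s q<p) p<k′ left right)
    where
    p<k : p < k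
    p<k = ≰⇒> k≰p
    p<k′ : p < length (take k s)
    p<k′ = subst (p <_) (sym (List.length-take k s)) (⊓-glb p<k p<n)
    q<p∸1 : q < p ∸ 1
    q<p∸1 = <-≤-trans q<j (<⇒≤pred j<p)
    p∸1<p : p ∸ 1 < p
    p∸1<p = ∸-monoʳ-< {p} {1} {0} z<s (<-≤-trans z<s q<p)
    -- the left neighbour of p lies between q and p, so it is ≥ w > v
    left : (at (take k s) (p ∸ 1) <ᵇ at (take k s) p) ≡ (at (take k s) (p ∸ 1) <ᵇ w)
    left rewrite at-take s k (p ∸ 1) (<-trans p∸1<p p<k) | at-take s k p p<k | s[p]≡v =
      trans (≥⇒<ᵇ-false (<⇒≤ (<-≤-trans v<w (between (p ∸ 1) q<p∸1 p∸1<p)))) (sym (≥⇒<ᵇ-false (between (p ∸ 1) q<p∸1 p∸1<p)))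
    right : suc p < length (take k s) → (at (take k s) p <ᵇ at (take k s) (suc p)) ≡ (w <ᵇ at (take k s) (suc p))
    right 1+p<k′ rewrite at-take s k p p<k | at-take s k (suc p) (<-≤-trans 1+p<k′ (≤-trans (≤-reflexive (List.length-take k s)) (m⊓n≤m k _)))
                       | s[p]≡v = trans (<⇒<ᵇ-true (<-trans v<w w<)) (sym (<⇒<ᵇ-true w<))
      where
      w< : w < at s (suc p)
      w< = after (suc p) ≤-refl (<-≤-trans 1+p<k′ (≤-trans (≤-reflexive (List.length-take k s)) (m⊓n≤n k _)))

  asc-t≡s : asc t ≡ asc s
  asc-t≡s = begin
    asc t                     ≡⟨ cong asc (sym (take-length t)) ⟩
    asc (take (length t) t)   ≡⟨ cong (λ z → asc (take z t)) length-t ⟩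
    asc (take (length s) t)   ≡⟨ asc-take-t≡s (length s) ⟩
    asc (take (length s) s)   ≡⟨ cong asc (take-length s) ⟩
    asc s                     ∎
    where open ≡-Reasoning

  isAscent-s⇒t : IsAscent s → IsAscent t
  isAscent-s⇒t s↑ k k<n with k ≟ p
  ... | yes refl = subst (_< suc k) (sym t[p]≡w) w<1+p ,
                   (λ _ → subst₂ _≤_ (sym t[p]≡w) (cong (_+ 1) (sym (asc-take-t≡s k))) w≤asc+1)
    where
    j<n : j < length s
    j<n = <-trans j<p p<n
    w<1+p : w < suc p
    w<1+p = subst (_< suc p) s[j]≡w (<-trans (ascent-< s↑ j j<n) (s≤s j<p))
    -- w already occurs at the earlier position j
    w≤asc+1 : w ≤ asc (take p s) + 1
    w≤asc+1 = ≤-trans (subst (_≤ asc (take (suc j) s)) s[j]≡w (ascent-entry≤asc s↑ j j<n))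
                      (≤-trans (asc-take-mono s (suc j) p j<p) (m≤m+n _ 1))
  ... | no k≢p = subst (_< suc k) (sym (t[k]≡s[k] k k≢p)) (ascent-< s↑ k k<n′) ,
                 (λ 1≤k → subst₂ _≤_ (sym (t[k]≡s[k] k k≢p)) (cong (_+ 1) (sym (asc-take-t≡s k))) (ascent-≤ s↑ k k<n′ 1≤k))
    where
    k<n′ : k < length s
    k<n′ = subst (k <_) length-t k<n

  isAscent-t⇒s : IsAscent t → IsAscent s
  isAscent-t⇒s t↑ k k<n with k ≟ p
  ... | yes refl = subst (_< suc k) (sym s[p]≡v) v<1+p ,
                   (λ 1≤k → subst (_≤ asc (take k s) + 1) (sym s[p]≡v)
                     (<⇒≤ (<-≤-trans v<w (subst₂ _≤_ t[p]≡w (cong (_+ 1) (asc-take-t≡s k)) (ascent-≤ t↑ k k<n′ 1≤k)))))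
    where
    k<n′ : k < length t
    k<n′ = subst (k <_) (sym length-t) k<n
    v<1+p : v < suc p
    v<1+p = subst (_< suc p) t[q]≡v (<-trans (ascent-< t↑ q (<-trans q<p p<length-t)) (s≤s q<p))
  ... | no k≢p = subst (_< suc k) (t[k]≡s[k] k k≢p) (ascent-< t↑ k k<n′) ,
                 (λ 1≤k → subst₂ _≤_ (t[k]≡s[k] k k≢p) (cong (_+ 1) (asc-take-t≡s k)) (ascent-≤ t↑ k k<n′ 1≤k))
    where
    k<n′ : k < length t
    k<n′ = subst (k <_) (sym length-t) k<n

  s≢upTo : s ≢ upTo (length s)
  s≢upTo s≡ = ≡upTo⇒distinct s q p q<p p<n s≡ (trans s[q]≡v (sym s[p]≡v))

  t≢upTo : t ≢ upTo (length t)
  t≢upTo t≡ = ≡upTo⇒distinct t j p j<p p<length-t t≡ (trans t[j]≡w (sym t[p]≡w))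

  private
    last-index : Σ ℕ λ m → length s ≡ suc m
    last-index with length s | p<n
    ... | suc m | _ = m , refl

  lastIsMasc-s⇒t : IsAscent s → LastIsMasc s → LastIsMasc t
  lastIsMasc-s⇒t s↑ masc with last-index
  ... | m , n≡ with m ≟ p
  ...   | yes refl = ⊥-elim (repeat⇒¬lastIsMasc s↑ q m q<p n≡ (trans s[p]≡v (sym s[q]≡v)) masc)
  ...   | no m≢p   = ⇒lastIsMasc t m (trans length-t n≡)
                       (trans (t[k]≡s[k] m m≢p) (trans (lastIsMasc⇒ s m n≡ masc) (cong (_+ 1) (sym (asc-take-t≡s m)))))

  lastIsMasc-t⇒s : IsAscent t → LastIsMasc t → LastIsMasc s
  lastIsMasc-t⇒s t↑ masc with last-index
  ... | m , n≡ with m ≟ p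
  ...   | yes refl = ⊥-elim (repeat⇒¬lastIsMasc t↑ j m j<p (trans length-t n≡) (trans t[p]≡w (sym t[j]≡w)) masc)
  ...   | no m≢p   = ⇒lastIsMasc s m n≡
                       (trans (sym (t[k]≡s[k] m m≢p)) (trans (lastIsMasc⇒ t m (trans length-t n≡) masc) (cong (_+ 1) (asc-take-t≡s m))))

  -- the value v removed at p survives at q, and the new value w was already present at j
  rep-t≡s : rep t ≡ rep s
  rep-t≡s = rep-sameElements t s length-t t⊆s s⊆t
    where
    t⊆s : ∀ x → x ∈ t → x ∈ s
    t⊆s x x∈ with ∈⇒at t x∈
    ... | k , k<n , refl with k ≟ p
    ...   | yes refl = subst (_∈ s) (trans s[j]≡w (sym t[p]≡w)) (at-∈ s j (<-trans j<p p<n))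
    ...   | no k≢p   = subst (_∈ s) (sym (t[k]≡s[k] k k≢p)) (at-∈ s k (subst (k <_) length-t k<n))
    s⊆t : ∀ x → x ∈ s → x ∈ t
    s⊆t x x∈ with ∈⇒at s x∈
    ... | k , k<n , refl with k ≟ p
    ...   | yes refl = subst (_∈ t) (trans t[q]≡v (sym s[p]≡v)) (at-∈ t q (<-trans q<p p<length-t))
    ...   | no k≢p   = subst (_∈ t) (t[k]≡s[k] k k≢p) (at-∈ t k (subst (k <_) (sym length-t) k<n))

  maxs-t≡s : IsAscent s → maxs t ≡ maxs s
  maxs-t≡s s↑ = trans (cong maxs t≡) (maxsAux-≔ 0 s p w (λ e → v≢p (trans (sym s[p]≡v) e)) w≢p)
    where
    before-p : ∀ k → k < p → at s k < p
    before-p k k<p = <-≤-trans (ascent-< s↑ k (<-trans k<p p<n)) k<p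
    v≢p : v ≢ p
    v≢p = <⇒≢ (subst (_< p) s[q]≡v (before-p q q<p))
    w≢p : w ≢ p
    w≢p = <⇒≢ (subst (_< p) s[j]≡w (before-p j j<p))

  -- v = Rmin(s)_r is 0 exactly when r = 0, since Rmin(s)_0 is the minimum of s and s_1 = 0
  v≡0⇔r≡0 : IsAscent s → (v ≡ᵇ 0) ≡ (r ≡ᵇ 0)
  v≡0⇔r≡0 s↑ with r in r≡
  ... | zero   = ≡⇒≡ᵇ-true (n≤0⇒n≡0 (begin
      v                 ≡⟨ sym (subst (λ z → rminValue s z ≡ v) r≡ rminValue-s-r) ⟩
      rminValue s 0     ≤⟨ rminValue-≤-after s 0 0 (subst (_< length (Prm s)) r≡ r<rmin) tt 0<n ⟩
      at s 0            ≤⟨ ≤-pred (ascent-< s↑ 0 0<n) ⟩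
      0                 ∎))
    where
    open ≤-Reasoning
    0<n : 0 < length s
    0<n = <-≤-trans z<s p<n
  ... | suc r′ = ≢⇒≡ᵇ-false (λ v≡0 → n≮0 (subst (rminValue s 0 <_) (trans (subst (λ z → rminValue s z ≡ v) r≡ rminValue-s-r) v≡0)
                   (rminValue-< s 0 (suc r′) z<s (subst (_< length (Prm s)) r≡ r<rmin))))

  zeros-s≡ : IsAscent s → zeros s ≡ zeros t + χ (r ≡ᵇ 0)
  zeros-s≡ s↑ = begin
    zeros s                                 ≡⟨ +-identityʳ _ ⟨
    zeros s + b2n false                     ≡⟨ cong (λ b → zeros s + b2n b) (sym w≢0) ⟩
    zeros s + b2n (w ≡ᵇ 0)                  ≡⟨ countB-≔ (_≡ᵇ 0) s p w p<n ⟨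
    zeros (s [ p ]≔ w) + b2n (at s p ≡ᵇ 0)  ≡⟨ cong₂ _+_ (cong zeros (sym t≡)) (cong b2n (trans (cong (_≡ᵇ 0) s[p]≡v) (v≡0⇔r≡0 s↑))) ⟩
    zeros t + χ (r ≡ᵇ 0)                    ∎
    where
    open ≡-Reasoning
    w≢0 : (w ≡ᵇ 0) ≡ false
    w≢0 = ≢⇒≡ᵇ-false (λ w≡0 → n≮0 (subst (v <_) w≡0 v<w))

  -- if p is the first non-fixed point, the fixed points q, q+1, ..., j squeeze w to v + 1
  ealm-t≡ : IsAscent s → ealm t ≡ ealm s + χ (suc p ≡ᵇ maxs s + 1)
  ealm-t≡ s↑ with maxs-first-nonfixed s↑ s≢upTo
  ... | K , K<n , fixed , _ , maxs≡K
    rewrite ealm-at s K maxs≡K K<n | ealm-at t K (trans (maxs-t≡s s↑) maxs≡K) (subst (K <_) (sym length-t) K<n)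
          | maxs≡K | +-comm K 1 with p ≟ K
  ... | yes refl rewrite ≡⇒≡ᵇ-true {p} refl = trans t[p]≡w (trans w≡v+1 (cong (_+ 1) (sym s[p]≡v)))
    where
    1+q<p : suc q < p
    1+q<p = ≤-trans (s≤s q<j) j<p
    w≡v+1 : w ≡ v + 1
    w≡v+1 = trans (≤-antisym (subst (w ≤_) (fixed (suc q) 1+q<p) (between (suc q) ≤-refl 1+q<p))
                             (subst (suc q ≤_) (trans (sym (fixed j j<p)) s[j]≡w) q<j))
                  (trans (cong suc (trans (sym (fixed q q<p)) s[q]≡v)) (+-comm 1 v))
  ... | no p≢K rewrite ≢⇒≡ᵇ-false p≢K = trans (t[k]≡s[k] K (≢-sym p≢K)) (sym (+-identityʳ _))

  f₄-s≡t : rpos s ≡ r → f₄ s ≡ t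
  f₄-s≡t rpos≡r = trans (cong₂ (s [_]≔_) position (sebr-s≡w rpos≡r)) (sym t≡)
    where
    position : at (Prm s) (rpos s) ∸ 1 ≡ p
    position = trans (cong (λ z → at (Prm s) z ∸ 1) rpos≡r) (cong (_∸ 1) (proj₁ Prm-s[r]))

  f₄⁻¹-t≡s : rpos s ≡ r → f₄⁻¹ t ≡ s
  f₄⁻¹-t≡s rpos≡r = begin
    t [ at (Prm t) (rpos t) ∸ 1 ]≔ at (Rmin t) (rpos t ∸ 1) ≡⟨ cong₂ (t [_]≔_) position value ⟩
    t [ p ]≔ v                                              ≡⟨ cong (_[ p ]≔ v) t≡ ⟩
    s [ p ]≔ w [ p ]≔ v                                     ≡⟨ ≔-≔ s p w v ⟩
    s [ p ]≔ v                                              ≡⟨ cong (s [ p ]≔_) (sym s[p]≡v) ⟩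
    s [ p ]≔ at s p                                         ≡⟨ ≔-at s p ⟩
    s                                                       ∎
    where
    open ≡-Reasoning
    position : at (Prm t) (rpos t) ∸ 1 ≡ p
    position = trans (cong (λ z → at (Prm t) z ∸ 1) (rpos-t≡ rpos≡r)) (cong (_∸ 1) Prm-t[1+r])
    value : at (Rmin t) (rpos t ∸ 1) ≡ v
    value = trans (cong (λ z → at (Rmin t) (z ∸ 1)) (rpos-t≡ rpos≡r))
                  (trans (at-Rmin t r (subst (r <_) (sym length-Prm-t) (<-trans r<rmin ≤-refl))) rminValue-t-r)

record RaiseAt (s t : List ℕ) (R : ℕ) : Set where
  constructor raiseAt
  field
    {q p v w} : ℕ
    raise     : Raise s t q p v w
    r≡R       : RaiseProperties.r raise ≡ R

-- Constructing the raise from either side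

record LastTwoOccurrences (s : List ℕ) (V a b : ℕ) : Set where
  field
    a<b    : a < b
    b<n    : b < length s
    s[a]≡V : at s a ≡ V
    s[b]≡V : at s b ≡ V
    only   : ∀ k → k < length s → at s k ≡ V → k ≤ a ⊎ k ≡ b

lastTwo-occPos : ∀ s V {a₁ b₁} → LastTwo (occPos V s) a₁ b₁ →
                 Σ ℕ λ a → Σ ℕ λ b → a₁ ≡ suc a × b₁ ≡ suc b × LastTwoOccurrences s V a b
lastTwo-occPos s V (a∈ , b∈ , a₁<b₁ , top) with ∈-occPos⁻ V s _ a∈ | ∈-occPos⁻ V s _ b∈
... | a , _ , refl , s[a]≡V | b , b<n , refl , s[b]≡V = a , b , refl , refl , record
  { a<b    = ≤-pred a₁<b₁
  ; b<n    = b<n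
  ; s[a]≡V = s[a]≡V
  ; s[b]≡V = s[b]≡V
  ; only   = only
  }
  where
  only : ∀ k → k < length s → at s k ≡ V → k ≤ a ⊎ k ≡ b
  only k k<n s[k]≡V with top (suc k) (∈-occPos⁺ V s k k<n s[k]≡V)
  ... | inj₁ 1+k≤1+a = inj₁ (≤-pred 1+k≤1+a)
  ... | inj₂ 1+k≡1+b = inj₂ (suc-injective 1+k≡1+b)

sebr≢0⇒lastTwoOccurrences : ∀ s → sebr s ≢ 0 → Σ ℕ λ a → Σ ℕ λ b →
                            LastTwoOccurrences s (at (Rmin s) (rpos s)) a b × sebr s ≡ minList (Between s a b)
sebr≢0⇒lastTwoOccurrences s sebr≢0 with sebrAux≢0⇒lastTwo s (occPos-increasing (at (Rmin s) (rpos s)) s) sebr≢0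
... | a₁ , b₁ , lastTwo with lastTwo-occPos s _ lastTwo
... | a , b , refl , refl , occurrences = a , b , occurrences , sebrAux-lastTwo s (occPos-increasing _ s) lastTwo

module _ {s V a b} (occurrences : LastTwoOccurrences s V a b) where
  open LastTwoOccurrences occurrences

  lastTwoOccurrences⇒rmin≢length : rmin s ≢ length s
  lastTwoOccurrences⇒rmin≢length e = <-irrefl (trans s[a]≡V (sym s[b]≡V))
    (length-Prm≡⇒isRmin s (trans (sym (rmin≡length-Prm s)) e) a (<-trans a<b b<n) b a<b b<n)

  lastTwoOccurrences-isRmin : ∀ x → x < length s → IsRmin s x → at s x ≡ V → b ≡ x
  lastTwoOccurrences-isRmin x x<n rm s[x]≡V with <-cmp b x
  ... | tri≈ _ b≡x _ = b≡x
  ... | tri> _ _ x<b = ⊥-elim (<-irrefl (trans s[x]≡V (sym s[b]≡V)) (rm b x<b b<n))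
  ... | tri< b<x _ _ with only x x<n s[x]≡V
  ...   | inj₁ x≤a = ⊥-elim (<⇒≱ (<-trans a<b b<x) x≤a)
  ...   | inj₂ x≡b = ⊥-elim (<-irrefl (sym x≡b) b<x)

  rposCond⇒afterRmin : ∀ m → V ≡ at (Rmin s) m → rposCond s m ≡ true → AfterRmin s m a
  rposCond⇒afterRmin m V≡ cond with rposCond⁻ s m cond
  ... | c , d , after-c , c<d , d<n , s[c] , s[d] with only c (<-trans c<d d<n) (trans s[c] (sym V≡))
  ...   | inj₁ c≤a  = afterRmin-≤ s m after-c c≤a
  ...   | inj₂ refl with only d d<n (trans s[d] (sym V≡))
  ...     | inj₁ d≤a = ⊥-elim (<⇒≱ (<-trans a<b c<d) d≤a)
  ...     | inj₂ d≡b = ⊥-elim (<-irrefl (sym d≡b) c<d)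

  rposCond-rpos-twice : V ≡ at (Rmin s) (rpos s) → rposCond s (rpos s) ≡ true
  rposCond-rpos-twice V≡ = rposCond-rpos s lastTwoOccurrences⇒rmin≢length
    (λ rpos≡0 → let V≡Rmin[0] = trans V≡ (cong (at (Rmin s)) rpos≡0) in
                rposCond⁺ s 0 a b tt a<b b<n (trans s[a]≡V V≡Rmin[0]) (trans s[b]≡V V≡Rmin[0]))

  lastTwoOccurrences-rpos<length-Prm : rpos s < length (Prm s)
  lastTwoOccurrences-rpos<length-Prm = rpos<length-Prm s lastTwoOccurrences⇒rmin≢length (rmin>0 s (<-≤-trans z<s b<n))

  -- Rmin(s)_m bounds everything after the first m minima from below, and V occurs only at a and b
  lastTwoOccurrences-between : ∀ m → m < length (Prm s) → V ≡ at (Rmin s) m → AfterRmin s m a →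
                               ∀ k → a < k → k < b → V < at s k
  lastTwoOccurrences-between m m<P V≡ after-a k a<k k<b with m≤n⇒m<n∨m≡n V≤s[k]
    where
    V≤s[k] : V ≤ at s k
    V≤s[k] = subst (_≤ at s k) (sym (trans V≡ (at-Rmin s m m<P)))
                   (rminValue-≤-after s m k m<P (afterRmin-≤ s m after-a (<⇒≤ a<k)) (<-trans k<b b<n))
  ... | inj₁ V<s[k] = V<s[k]
  ... | inj₂ V≡s[k] with only k (<-trans k<b b<n) (sym V≡s[k])
  ...   | inj₁ k≤a = ⊥-elim (<⇒≱ a<k k≤a)
  ...   | inj₂ k≡b = ⊥-elim (<-irrefl k≡b k<b)

-- the bound on sebr in 𝒜² makes every entry after the R-th right-to-left minimum exceed w
beyond-rmin : ∀ s R x w → at (Prm s) R ≡ suc x → (suc R ≡ rmin s) ⊎ (w < at (Rmin s) (suc R)) →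
              ∀ k → x < k → k < length s → w < at s k
beyond-rmin s R x w P[R] (inj₁ 1+R≡rmin) k x<k k<n with length s in n≡ | k<n
... | suc m | _ with Prm-last s m n≡
...   | L , P≡1+L , P[L] = ⊥-elim (<⇒≱ x<k (≤-pred (subst (k <_) (sym 1+x≡n) k<n)))
  where
  1+x≡n : suc x ≡ length s
  1+x≡n = begin
    suc x          ≡⟨ P[R] ⟨
    at (Prm s) R   ≡⟨ cong (at (Prm s)) (suc-injective (trans 1+R≡rmin (trans (rmin≡length-Prm s) P≡1+L))) ⟩
    at (Prm s) L   ≡⟨ P[L] ⟩
    suc m          ≡⟨ n≡ ⟨
    length s       ∎
    where open ≡-Reasoning
beyond-rmin s R x w P[R] (inj₂ w<Rmin) k x<k k<n with suc R <? length (Prm s)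
... | no  1+R≮P = ⊥-elim (n≮0 (subst (w <_) Rmin[1+R]≡0 w<Rmin))
  where
  Rmin[1+R]≡0 : at (Rmin s) (suc R) ≡ 0
  Rmin[1+R]≡0 = at-beyond (Rmin s) (suc R) (subst (_≤ suc R) (sym (rmin≡length-Prm s)) (≮⇒≥ 1+R≮P))
... | yes 1+R<P = <-≤-trans (subst (w <_) (at-Rmin s (suc R) 1+R<P) w<Rmin)
                            (rminValue-≤-after s (suc R) k 1+R<P (subst (_≤ k) (sym P[R]) x<k) k<n)

lastTwoOccurrences⇒raiseAt : ∀ s {a b j} → LastTwoOccurrences s (at (Rmin s) (rpos s)) a b →
                             a < j → j < b → at s j ≡ sebr s → (∀ k → a < k → k < b → sebr s ≤ at s k) →
                             (suc (rpos s) ≡ rmin s) ⊎ (sebr s < at (Rmin s) (suc (rpos s))) → RaiseAt s (f₄ s) (rpos s)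
lastTwoOccurrences⇒raiseAt s {a} {b} {j} occurrences a<j j<b s[j]≡w between bound
  with at-Prm s (rpos s) (lastTwoOccurrences-rpos<length-Prm occurrences)
... | x , P[R]≡1+x , x<n , isRmin-x = raiseAt raise r≡R
  where
  open LastTwoOccurrences occurrences
  R = rpos s
  V = at (Rmin s) R
  R<P = lastTwoOccurrences-rpos<length-Prm occurrences
  s[x]≡V : at s x ≡ V
  s[x]≡V = sym (trans (at-Rmin s R R<P) (cong (λ z → at s (z ∸ 1)) P[R]≡1+x))
  b≡x : b ≡ x
  b≡x = lastTwoOccurrences-isRmin occurrences x x<n isRmin-x s[x]≡V
  after-a : AfterRmin s R a
  after-a = rposCond⇒afterRmin occurrences R refl (rposCond-rpos-twice occurrences refl)
  raise : Raise s (f₄ s) a b V (sebr s)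
  raise = record
    { p<n     = b<n
    ; q<p     = a<b
    ; t≡      = cong (λ z → s [ z ]≔ sebr s) (trans (cong (_∸ 1) P[R]≡1+x) (sym b≡x))
    ; s[q]≡v  = s[a]≡V
    ; s[p]≡v  = s[b]≡V
    ; v<w     = subst (V <_) s[j]≡w (lastTwoOccurrences-between occurrences R R<P refl after-a j a<j j<b)
    ; j       = j
    ; q<j     = a<j
    ; j<p     = j<b
    ; s[j]≡w  = s[j]≡w
    ; between = between
    ; after   = λ k b<k → beyond-rmin s R x (sebr s) P[R]≡1+x bound k (subst (_< k) b≡x b<k)
    }
  r≡R : RaiseProperties.r raise ≡ R
  r≡R = increasing⇒at-injective (Prm-increasing s) _ R (RaiseProperties.r<rmin raise) R<P
          (trans (proj₁ (RaiseProperties.Prm-s[r] raise)) (trans (cong suc b≡x) (sym P[R]≡1+x)))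

f₄-raiseAt : ∀ s → sebr s ≢ 0 → (suc (rpos s) ≡ rmin s) ⊎ (sebr s < at (Rmin s) (suc (rpos s))) → RaiseAt s (f₄ s) (rpos s)
f₄-raiseAt s sebr≢0 bound with sebr≢0⇒lastTwoOccurrences s sebr≢0
... | a , b , occurrences , sebr≡min
  with ∈-Between⁻ s a b _ (LastTwoOccurrences.a<b occurrences) (minList≢0⇒∈ _ (λ e → sebr≢0 (trans sebr≡min e)))
... | j , a<j , j<b , _ , s[j]≡min = lastTwoOccurrences⇒raiseAt s occurrences a<j j<b (trans s[j]≡min (sym sebr≡min)) between bound
  where
  between : ∀ k → a < k → k < b → sebr s ≤ at s k
  between k a<k k<b = subst (_≤ at s k) (sym sebr≡min)
    (minList-≤ _ _ (∈-Between⁺ s a b k a<k k<b (<-trans k<b (LastTwoOccurrences.b<n occurrences))))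

raise-intro : ∀ t q p j → p < length t → q < p → q < j → j < p → at t j ≡ at t p → at t q < at t p →
              (∀ k → q < k → k < p → at t p ≤ at t k) → (∀ k → p < k → k < length t → at t p < at t k) →
              Raise (t [ p ]≔ at t q) t q p (at t q) (at t p)
raise-intro t q p j p<n q<p q<j j<p t[j]≡w v<w between after = record
  { p<n     = subst (p <_) (sym (length-≔ t p v)) p<n
  ; q<p     = q<p
  ; t≡      = sym (trans (≔-≔ t p v w) (≔-at t p))
  ; s[q]≡v  = at-≔-other t p v q (<⇒≢ q<p)
  ; s[p]≡v  = at-≔-same t p v p<n
  ; v<w     = v<w
  ; j       = j
  ; q<j     = q<j
  ; j<p     = j<p
  ; s[j]≡w  = trans (at-≔-other t p v j (<⇒≢ j<p)) t[j]≡w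
  ; between = λ k q<k k<p → subst (w ≤_) (sym (at-≔-other t p v k (<⇒≢ k<p))) (between k q<k k<p)
  ; after   = λ k p<k k<n → subst (w <_) (sym (at-≔-other t p v k (≢-sym (<⇒≢ p<k))))
                                  (after k p<k (subst (k <_) (length-≔ t p v) k<n))
  }
  where
  v = at t q
  w = at t p

lowering-raiseAt : ∀ t r → suc r < length (Prm t) → rposCond t (suc r) ≡ true →
                   RaiseAt (t [ at (Prm t) (suc r) ∸ 1 ]≔ rminValue t r) t r
lowering-raiseAt t r 1+r<P cond
  with at-Prm t r (<-trans ≤-refl 1+r<P) | at-Prm t (suc r) 1+r<P | rposCond⁻ t (suc r) cond
... | q , P[r] , _ , _ | p , P[1+r] , p<n , isRmin-p | c , d , P[r]≤c , c<d , d<n , t[c] , t[d]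
  rewrite P[r] | P[1+r] = raiseAt raise r≡
  where
  w≡ : at (Rmin t) (suc r) ≡ at t p
  w≡ = trans (at-Rmin t (suc r) 1+r<P) (cong (λ z → at t (z ∸ 1)) P[1+r])
  q<p : q < p
  q<p = ≤-pred (subst₂ _<_ P[r] P[1+r] (increasing⇒at-< (Prm-increasing t) r (suc r) ≤-refl 1+r<P))
  c<p : c < p
  c<p with <-cmp c p
  ... | tri< c<p _ _ = c<p
  ... | tri≈ _ refl _ = ⊥-elim (<-irrefl (sym (trans t[d] w≡)) (isRmin-p d c<d d<n))
  ... | tri> _ _ p<c = ⊥-elim (<-irrefl (sym (trans t[c] w≡)) (isRmin-p c p<c (<-trans c<d d<n)))
  raise = raise-intro t q p c p<n q<p P[r]≤c c<p (trans t[c] w≡)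
    (subst₂ _<_ (cong (λ z → at t (z ∸ 1)) P[r]) (cong (λ z → at t (z ∸ 1)) P[1+r]) (rminValue-< t r (suc r) ≤-refl 1+r<P))
    (λ k q<k k<p → subst (_≤ at t k) (cong (λ z → at t (z ∸ 1)) P[1+r])
                      (rminValue-≤-after t (suc r) k 1+r<P (subst (_≤ k) (sym P[r]) q<k) (<-trans k<p p<n)))
    isRmin-p
  open RaiseProperties raise using (length-Prm-t; r<rmin; Prm-t[1+r]) renaming (r to r′)
  r≡ : r′ ≡ r
  r≡ = suc-injective (increasing⇒at-injective (Prm-increasing t) (suc r′) (suc r)
         (subst (suc r′ <_) (sym length-Prm-t) (s≤s r<rmin)) 1+r<P (trans Prm-t[1+r] (sym P[1+r])))

f₄⁻¹-raiseAt : ∀ t r → rpos t ≡ suc r → RaiseAt (f₄⁻¹ t) t r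
f₄⁻¹-raiseAt t r rpos≡1+r = subst (λ s → RaiseAt s t r) (sym f₄⁻¹t≡) (lowering-raiseAt t r 1+r<P cond)
  where
  rpos≢0 : rpos t ≢ 0
  rpos≢0 e = 1+n≢0 (trans (sym rpos≡1+r) e)
  rmin≢n = proj₁ (rpos≢0⇒ t rpos≢0)
  1+r<P : suc r < length (Prm t)
  1+r<P = subst (_< length (Prm t)) rpos≡1+r (rpos<length-Prm t rmin≢n (proj₂ (rpos≢0⇒ t rpos≢0)))
  cond : rposCond t (suc r) ≡ true
  cond = subst (λ z → rposCond t z ≡ true) rpos≡1+r (rposCond-rpos t rmin≢n (⊥-elim ∘′ rpos≢0))
  f₄⁻¹t≡ : f₄⁻¹ t ≡ t [ at (Prm t) (suc r) ∸ 1 ]≔ rminValue t r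
  f₄⁻¹t≡ rewrite rpos≡1+r = cong (t [ at (Prm t) (suc r) ∸ 1 ]≔_) (at-Rmin t r (<-trans ≤-refl 1+r<P))

StatisticsMatch : List ℕ → List ℕ → Set
StatisticsMatch s t =
    (asc s ≡ asc t)
  × (rep s ≡ rep t)
  × (maxs s ≡ maxs t)
  × (rmin t ≡ rmin s + 1)
  × (rpos t ≡ rpos s + 1)
  × (zeros s ≡ zeros t + χ (rpos s ≡ᵇ 0))
  × (ealm t ≡ ealm s + χ (at (Prm s) (rpos s) ≡ᵇ maxs s + 1))

module _ {s t R} (s↝t : RaiseAt s t R) where
  open RaiseAt s↝t
  open RaiseProperties raise

  raiseAt-rpos : rpos s ≡ R → rpos t ≡ suc R
  raiseAt-rpos rpos≡R = subst (λ z → rpos t ≡ suc z) r≡R (rpos-t≡ (trans rpos≡R (sym r≡R)))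

  raiseAt-codomain : rpos s ≡ R → IsAscent s → ¬ LastIsMasc s → Cod (length s) t
  raiseAt-codomain rpos≡R s↑ ¬masc =
    length-t , (isAscent-s⇒t s↑ , t≢upTo) , (λ P₁t → ¬masc (lastIsMasc-t⇒s t↑ (P₁⇒lastIsMasc t P₁t))) ,
    (λ rpos≡0 → 1+n≢0 (trans (sym (raiseAt-rpos rpos≡R)) rpos≡0))
    where
    t↑ = isAscent-s⇒t s↑

  raiseAt-domain : suc R ≡ rpos t → AStar t → ¬ P₁ t → T₄ s × (f₄ s ≡ t)
  raiseAt-domain 1+R≡rpos t* ¬P₁t = (((s↑ , s≢upTo) , sebr≢0 , bound) , ¬masc) , f₄-s≡t rpos≡r
    where
    rpos≡r : rpos s ≡ r
    rpos≡r = rpos-s≡ (trans (sym 1+R≡rpos) (cong suc (sym r≡R)))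
    s↑ = isAscent-t⇒s (proj₁ t*)
    sebr≢0 : sebr s ≢ 0
    sebr≢0 sebr≡0 = n≮0 (subst (v <_) (trans (sym (sebr-s≡w rpos≡r)) sebr≡0) v<w)
    bound : (suc (rpos s) ≡ rmin s) ⊎ (sebr s < at (Rmin s) (suc (rpos s)))
    bound = subst₂ (λ a b → (suc a ≡ rmin s) ⊎ (b < at (Rmin s) (suc a))) (sym rpos≡r) (sym (sebr-s≡w rpos≡r)) w<Rmin-s[1+r]
    2≤n : 2 ≤ length t
    2≤n = subst (2 ≤_) (sym length-t) (≤-trans (s≤s (<-≤-trans z<s q<p)) p<n)
    ¬masc : ¬ LastIsMasc s
    ¬masc masc = ¬P₁t (lastIsMasc⇒P₁ t t* 2≤n (lastIsMasc-s⇒t s↑ masc))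

  raiseAt-f₄⁻¹ : rpos s ≡ R → f₄⁻¹ t ≡ s
  raiseAt-f₄⁻¹ rpos≡R = f₄⁻¹-t≡s (trans rpos≡R (sym r≡R))

  raiseAt-statistics : rpos s ≡ R → IsAscent s → StatisticsMatch s t
  raiseAt-statistics rpos≡R s↑ =
    sym asc-t≡s , sym rep-t≡s , sym (maxs-t≡s s↑) , trans rmin-t≡ (+-comm 1 _) ,
    trans (raiseAt-rpos rpos≡R) (trans (cong suc (sym rpos≡R)) (+-comm 1 _)) ,
    subst (λ z → zeros s ≡ zeros t + χ (z ≡ᵇ 0)) (sym rpos≡r) (zeros-s≡ s↑) ,
    subst (λ z → ealm t ≡ ealm s + χ (z ≡ᵇ maxs s + 1)) (trans (sym (proj₁ Prm-s[r])) (cong (at (Prm s)) (sym rpos≡r))) (ealm-t≡ s↑)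
    where
    rpos≡r : rpos s ≡ r
    rpos≡r = trans rpos≡R (sym r≡R)

lemma18 : (n : ℕ) → Σ (List ℕ → List ℕ) λ f →
    ((s : List ℕ) → Dom n s → Cod n (f s))
  × ((s t : List ℕ) → Dom n s → Dom n t → f s ≡ f t → s ≡ t)
  × ((t : List ℕ) → Cod n t → ∃ λ s → Dom n s × (f s ≡ t))
  × ((s : List ℕ) → Dom n s →
        (asc s ≡ asc (f s))
      × (rep s ≡ rep (f s))
      × (maxs s ≡ maxs (f s))
      × (rmin (f s) ≡ rmin s + 1)
      × (rpos (f s) ≡ rpos s + 1)
      × (zeros s ≡ zeros (f s) + χ (rpos s ≡ᵇ 0))
      × (ealm (f s) ≡ ealm s + χ (at (Prm s) (rpos s) ≡ᵇ maxs s + 1)))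
lemma18 n = f₄ , into , injective , onto , statistics
  where
  s↝f₄s : ∀ s → Dom n s → RaiseAt s (f₄ s) (rpos s)
  s↝f₄s s ((((_ , _) , sebr≢0 , bound) , _) , _) = f₄-raiseAt s sebr≢0 bound

  into : ∀ s → Dom n s → Cod n (f₄ s)
  into s d@((((s↑ , _) , _) , ¬masc) , refl) = raiseAt-codomain (s↝f₄s s d) refl s↑ ¬masc

  injective : ∀ s t → Dom n s → Dom n t → f₄ s ≡ f₄ t → s ≡ t
  injective s t ds dt f₄s≡f₄t = begin
    s             ≡⟨ raiseAt-f₄⁻¹ (s↝f₄s s ds) refl ⟨
    f₄⁻¹ (f₄ s)   ≡⟨ cong f₄⁻¹ f₄s≡f₄t ⟩
    f₄⁻¹ (f₄ t)   ≡⟨ raiseAt-f₄⁻¹ (s↝f₄s t dt) refl ⟩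
    t             ∎
    where open ≡-Reasoning

  onto : ∀ t → Cod n t → ∃ λ s → Dom n s × (f₄ s ≡ t)
  onto t (refl , t* , ¬P₁t , rpos≢0) =
    let (r , rpos≡) = ≢0⇒≡suc rpos≢0
        (T₄s , f₄s≡t) = raiseAt-domain (f₄⁻¹-raiseAt t r rpos≡) (sym rpos≡) t* ¬P₁t
    in f₄⁻¹ t , (T₄s , length-≔ t _ _) , f₄s≡t

  statistics : ∀ s → Dom n s → StatisticsMatch s (f₄ s)
  statistics s d@((((s↑ , _) , _) , _) , _) = raiseAt-statistics (s↝f₄s s d) refl s↑
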